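{- Let $(G,\sigma)$ be a signed graph without long barbells and let $(\tau,f)$ be a non-negative $k$-flow of $(G,\sigma)$, where $k\ge 2$ is an integer. Then $(\tau,f)=\sum_{i=1}^{k-1}(\tau,f_i)$, i.e. $f=\sum_{i=1}^{k-1}f_i$, where each $(\tau,f_i)$ is a non-negative $2$-flow of $(G,\sigma)$.
   Context: A signed graph $(G,\sigma)$ is a graph $G$ with a signature $\sigma:E(G)\to\{ -1,+1\}$; edges with $\sigma(e)=-1$ are negative. A circuit is balanced if it contains an even number of negative edges and unbalanced otherwise. A long barbell is the union of two vertex-disjoint unbalanced circuits together with a path meeting the circuits only at its two ends. Each edge $e=uv$ consists of half-edges $h_e^u$ and $h_e^v$; $H(v)$ is the set of half-edges at $v$. An orientation is a map $\tau$ from half-edges to $\{\pm1\}$ with $\tau(h_e^u)\tau(h_e^v)=-\sigma(e)$ for each edge $e=uv$. For $f:E(G)\to\mathbb{R}$, $(\tau,f)$ is a flow if $\sum_{h\in H(v)}\tau(h)f(e_h)=0$ for every vertex $v$ ($e_h$ the edge containing $h$). A $k$-flow is a flow with $f(e)\in\mathbb{Z}$ and $|f(e)|\le k-1$ for all $e$; it is non-negative if $f(e)\ge 0$ for all $e$. A $2$-flow thus has values in $\{ -1,0,1\}$. -}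

module Defs where

open import Data.Nat using (ℕ; zero; suc; _%_)
open import Data.Integer as ℤ using (ℤ; 0ℤ; 1ℤ; -_; _≤_)
open import Data.Fin using (Fin; zero; suc; inject₁; fromℕ)
open import Data.Fin.Properties using (_≟_)
open import Data.Bool using (Bool; true; false; if_then_else_)
open import Data.Product using (Σ; _×_; _,_; proj₁; proj₂; ∃)
open import Data.Sum using (_⊎_)
open import Data.Sign as Sign using (Sign)
open import Function.Definitions using (Injective)
open import Relation.Binary.PropositionalEquality using (_≡_; _≢_)
open import Relation.Nullary using (¬_; does)

-- A (finite) signed graph; loops and parallel edges allowed.  Edge e has two half-edges
-- (e , false) and (e , true), attached to proj₁ (ends e) and proj₂ (ends e).
record SignedGraph : Set where
  field
    n    : ℕ
    m    : ℕ
    ends : Fin m → Fin n × Fin n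
    σ    : Fin m → Sign          -- Sign.- = negative edge
open SignedGraph public

HalfEdge : SignedGraph → Set
HalfEdge G = Fin (m G) × Bool

attach : (G : SignedGraph) → HalfEdge G → Fin (n G)
attach G (e , false) = proj₁ (ends G e)
attach G (e , true)  = proj₂ (ends G e)

IsOrientation : (G : SignedGraph) → (HalfEdge G → Sign) → Set
IsOrientation G τ = ∀ e → τ (e , false) Sign.* τ (e , true) ≡ Sign.opposite (σ G e)

sumℤ : (k : ℕ) → (Fin k → ℤ) → ℤ
sumℤ zero    g = 0ℤ
sumℤ (suc k) g = g zero ℤ.+ sumℤ k (λ i → g (suc i))

sumℕ : (k : ℕ) → (Fin k → ℕ) → ℕ
sumℕ zero    g = 0
sumℕ (suc k) g = g zero Data.Nat.+ sumℕ k (λ i → g (suc i))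

signℤ : Sign → ℤ → ℤ
signℤ Sign.+ x = x
signℤ Sign.- x = - x

contrib : (G : SignedGraph) → (HalfEdge G → Sign) → (Fin (m G) → ℤ) →
          Fin (n G) → HalfEdge G → ℤ
contrib G τ f v h = if does (attach G h ≟ v) then signℤ (τ h) (f (proj₁ h)) else 0ℤ

IsFlow : (G : SignedGraph) → (HalfEdge G → Sign) → (Fin (m G) → ℤ) → Set
IsFlow G τ f = IsOrientation G τ ×
  (∀ v → sumℤ (m G) (λ e → contrib G τ f v (e , false) ℤ.+ contrib G τ f v (e , true)) ≡ 0ℤ)

∣_∣≤_ : ℤ → ℕ → Set
∣ x ∣≤ b = (- ℤ.+ b) ≤ x × x ≤ ℤ.+ b

IsKFlow : (k : ℕ) → (G : SignedGraph) → (HalfEdge G → Sign) → (Fin (m G) → ℤ) → Set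
IsKFlow k G τ f = IsFlow G τ f × (∀ e → ∣ f e ∣≤ (k Data.Nat.∸ 1))

NonNegative : {G : SignedGraph} → (Fin (m G) → ℤ) → Set
NonNegative f = ∀ e → 0ℤ ≤ f e

Joins : (G : SignedGraph) → Fin (m G) → Fin (n G) → Fin (n G) → Set
Joins G e a b = ends G e ≡ (a , b) ⊎ ends G e ≡ (b , a)

-- cyclic successor on Fin (suc l)
next : {l : ℕ} → Fin (suc l) → Fin (suc l)
next {zero}  zero    = zero
next {suc l} zero    = suc zero
next {suc l} (suc i) with next {l} i
... | zero  = zero
... | suc j = suc (suc j)

-- A circuit of length len = suc l: distinct vertices w 0, …, w l and distinct
-- edges c 0, …, c l with c i joining w i and w (i+1 mod len).
-- (len = 1: a loop; len = 2: two parallel edges.)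
record Circuit (G : SignedGraph) : Set where
  field
    l     : ℕ
    w     : Fin (suc l) → Fin (n G)
    c     : Fin (suc l) → Fin (m G)
    w-inj : Injective _≡_ _≡_ w
    c-inj : Injective _≡_ _≡_ c
    joins : ∀ i → Joins G (c i) (w i) (w (next i))
open Circuit public

isNeg : Sign → ℕ
isNeg Sign.- = 1
isNeg Sign.+ = 0

Unbalanced : {G : SignedGraph} → Circuit G → Set
Unbalanced {G} C = sumℕ (suc (l C)) (λ i → isNeg (σ G (c C i))) % 2 ≡ 1

OnCircuit : {G : SignedGraph} → Fin (n G) → Circuit G → Set
OnCircuit x C = ∃ λ i → w C i ≡ x

record Path (G : SignedGraph) : Set where
  field
    len   : ℕ
    p     : Fin (suc len) → Fin (n G)
    q     : Fin len → Fin (m G)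
    p-inj : Injective _≡_ _≡_ p
    joins : ∀ i → Joins G (q i) (p (inject₁ i)) (p (suc i))
open Path public

record LongBarbell (G : SignedGraph) : Set where
  field
    C₁ C₂     : Circuit G
    unbal₁    : Unbalanced C₁
    unbal₂    : Unbalanced C₂
    disjoint  : ∀ x → OnCircuit x C₁ → ¬ OnCircuit x C₂
    P         : Path G
    start     : OnCircuit (p P zero) C₁
    end       : OnCircuit (p P (fromℕ (len P))) C₂
    interior  : ∀ i → i ≢ zero → i ≢ fromℕ (len P) →
                ¬ OnCircuit (p P i) C₁ × ¬ OnCircuit (p P i) C₂

module Submission where

-- Write ∂f for the boundary of f (at each vertex the signed sum Σ τ(h) f(e_h)), so f is a
-- flow iff ∂f = 0; ∂ is ℤ-linear and invariant under reorienting edges.  A unit flow is a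
-- flow with values in {0, 1}.
--      A walk whose steps continue each other compatibly with τ is stopped at its first
--      repeated vertex.  The closed segment is a circuit; if balanced it carries a unit
--      flow.  If unbalanced, the walk is followed until it hits this circuit or itself
--      again, closing a balanced circuit, a short barbell or a theta (each carrying a unit
--      flow), or a long barbell, which is excluded by hypothesis.
--  (2) Continuation: at the far end of a positive edge of a non-negative flow ψ a positive
--      edge leaves compatibly (otherwise ∂ψ ≠ 0 there), so such walks exist in supp ψ.
--  (3) unit-flow-through: every positive edge e* of ψ lies on a unit flow inside supp ψ;
--      remove the unit flows of (1) from ψ until one uses e*, the weight Σ|ψ| decreasing.
--  (4) SaturatingLayer: if 0 ≤ f ≤ K+1, some unit flow g inside supp f covers every edge
--      with f = K+1: for an uncovered such edge, reorient f - (K+1)·g to be non-negative,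
--      take a unit flow through that edge by (3) and switch g along it.
--  (5) peel: removing saturating layers, by induction on K, proves the theorem.

open import Defs
open import Data.Nat as ℕ using (ℕ; zero; suc; z≤n; s≤s; _≤_; _<_; _∸_; _%_)
import Data.Nat.Properties as ℕP
open import Data.Integer as ℤ using (ℤ; 0ℤ; 1ℤ; -_; _+_; _-_; _*_; +≤+; +<+; -≤+)
import Data.Integer.Properties as ℤP
open ℤP hiding (_≟_)
open import Data.Integer.Tactic.RingSolver using (solve-∀)
open import Data.Fin using (Fin; zero; suc; toℕ; fromℕ)
import Data.Fin.Properties as FinP
open FinP using (_≟_)
open import Data.Bool using (Bool; true; false; if_then_else_; not)
import Data.Bool.Properties as BoolP
open import Data.Product using (Σ; _×_; _,_; proj₁; proj₂)
open import Data.Sum using (_⊎_; inj₁; inj₂)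
open import Data.Sign as Sign using (Sign)
import Data.Sign.Properties as SignP
open import Data.List using (List; []; _∷_; _++_)
open import Data.List.Relation.Unary.All as All using (All; []; _∷_)
import Data.List.Relation.Unary.All.Properties as AllP
open import Data.List.Relation.Unary.Any using (here; there)
open import Data.List.Membership.Propositional using (_∈_)
open import Data.List.Membership.Propositional.Properties using (∈-++⁻; ∈-++⁺ˡ)
open import Data.Unit using (⊤)
open import Data.Empty using (⊥; ⊥-elim)
open import Relation.Binary.PropositionalEquality
open import Relation.Binary.Definitions using (tri<; tri≈; tri>)
open import Relation.Nullary using (¬_; Dec; does; yes; no)
open import Relation.Nullary.Decidable using (_×-dec_; _⊎-dec_)


sumℤ-ext : ∀ k {f g : Fin k → ℤ} → (∀ i → f i ≡ g i) → sumℤ k f ≡ sumℤ k g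
sumℤ-ext zero    eq = refl
sumℤ-ext (suc k) eq = cong₂ _+_ (eq zero) (sumℤ-ext k (λ i → eq (suc i)))

interchange : ∀ a b c d → (a + b) + (c + d) ≡ (a + c) + (b + d)
interchange = solve-∀

sumℤ-+ : ∀ k (f g : Fin k → ℤ) → sumℤ k (λ i → f i + g i) ≡ sumℤ k f + sumℤ k g
sumℤ-+ zero    f g = refl
sumℤ-+ (suc k) f g =
  trans (cong ((f zero + g zero) +_) (sumℤ-+ k _ _)) (interchange (f zero) (g zero) _ _)

sumℤ-neg : ∀ k (f : Fin k → ℤ) → sumℤ k (λ i → - f i) ≡ - sumℤ k f
sumℤ-neg zero    f = refl
sumℤ-neg (suc k) f =
  trans (cong ((- f zero) +_) (sumℤ-neg k _)) (sym (neg-distrib-+ (f zero) _))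

sumℤ-scale : ∀ a k (f : Fin k → ℤ) → sumℤ k (λ i → a * f i) ≡ a * sumℤ k f
sumℤ-scale a zero    f = sym (*-zeroʳ a)
sumℤ-scale a (suc k) f =
  trans (cong (a * f zero +_) (sumℤ-scale a k _)) (sym (*-distribˡ-+ a (f zero) _))

sumℤ-zero : ∀ k (f : Fin k → ℤ) → (∀ i → f i ≡ 0ℤ) → sumℤ k f ≡ 0ℤ
sumℤ-zero zero    f eq = refl
sumℤ-zero (suc k) f eq = cong₂ _+_ (eq zero) (sumℤ-zero k _ (λ i → eq (suc i)))

sumℤ-single : ∀ k (f : Fin k → ℤ) (i₀ : Fin k) → (∀ i → i ≢ i₀ → f i ≡ 0ℤ) → sumℤ k f ≡ f i₀
sumℤ-single (suc k) f zero eq =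
  trans (cong (f zero +_) (sumℤ-zero k _ (λ i → eq (suc i) (λ ())))) (+-identityʳ _)
sumℤ-single (suc k) f (suc i₀) eq =
  trans (cong (_+ sumℤ k (λ i → f (suc i))) (eq zero (λ ())))
        (trans (+-identityˡ _)
               (sumℤ-single k _ i₀ (λ i ne → eq (suc i) (λ p → ne (FinP.suc-injective p)))))

sumℤ-nonneg : ∀ k (f : Fin k → ℤ) → (∀ i → 0ℤ ℤ.≤ f i) → 0ℤ ℤ.≤ sumℤ k f
sumℤ-nonneg zero    f nn = +≤+ z≤n
sumℤ-nonneg (suc k) f nn = +-mono-≤ (nn zero) (sumℤ-nonneg k _ (λ i → nn (suc i)))

sumℤ-positive : ∀ k (f : Fin k → ℤ) (i₀ : Fin k) →
                (∀ i → 0ℤ ℤ.≤ f i) → 0ℤ ℤ.< f i₀ → 0ℤ ℤ.< sumℤ k f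
sumℤ-positive (suc k) f zero nn pos =
  +-mono-<-≤ pos (sumℤ-nonneg k _ (λ i → nn (suc i)))
sumℤ-positive (suc k) f (suc i₀) nn pos =
  +-mono-≤-< (nn zero) (sumℤ-positive k _ i₀ (λ i → nn (suc i)) pos)

sumℕ-ext : ∀ k {f g : Fin k → ℕ} → (∀ i → f i ≡ g i) → sumℕ k f ≡ sumℕ k g
sumℕ-ext zero    eq = refl
sumℕ-ext (suc k) eq = cong₂ ℕ._+_ (eq zero) (sumℕ-ext k (λ i → eq (suc i)))

sumℕ-mono : ∀ k (f g : Fin k → ℕ) → (∀ i → f i ≤ g i) → sumℕ k f ≤ sumℕ k g
sumℕ-mono zero    f g le = z≤n
sumℕ-mono (suc k) f g le = ℕP.+-mono-≤ (le zero) (sumℕ-mono k _ _ (λ i → le (suc i)))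

sumℕ-strict : ∀ k (f g : Fin k → ℕ) → (∀ i → f i ≤ g i) → ∀ i₀ → f i₀ < g i₀ →
              sumℕ k f < sumℕ k g
sumℕ-strict (suc k) f g le zero lt = ℕP.+-mono-<-≤ lt (sumℕ-mono k _ _ (λ i → le (suc i)))
sumℕ-strict (suc k) f g le (suc i₀) lt =
  ℕP.+-mono-≤-< (le zero) (sumℕ-strict k _ _ (λ i → le (suc i)) i₀ lt)

signℤ-+ : ∀ t a b → signℤ t (a + b) ≡ signℤ t a + signℤ t b
signℤ-+ Sign.+ a b = refl
signℤ-+ Sign.- a b = neg-distrib-+ a b

signℤ-neg : ∀ t a → signℤ t (- a) ≡ - signℤ t a
signℤ-neg Sign.+ a = refl
signℤ-neg Sign.- a = refl

signℤ-scale : ∀ t a x → signℤ t (a * x) ≡ a * signℤ t x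
signℤ-scale Sign.+ a x = refl
signℤ-scale Sign.- a x = neg-distribʳ-* a x

signℤ-opposite : ∀ t a → signℤ (Sign.opposite t) a ≡ - signℤ t a
signℤ-opposite Sign.+ a = refl
signℤ-opposite Sign.- a = sym (neg-involutive a)

signℤ-* : ∀ s t x → signℤ s (signℤ t x) ≡ signℤ (s Sign.* t) x
signℤ-* Sign.- Sign.- x = neg-involutive x
signℤ-* Sign.- Sign.+ x = refl
signℤ-* Sign.+ Sign.- x = refl
signℤ-* Sign.+ Sign.+ x = refl

signℤ-twice : ∀ t x → signℤ t (signℤ t x) ≡ x
signℤ-twice Sign.- x = neg-involutive x
signℤ-twice Sign.+ x = refl

signℤ-0 : ∀ t → signℤ t 0ℤ ≡ 0ℤ
signℤ-0 Sign.- = refl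
signℤ-0 Sign.+ = refl

sumℤ-signℤ : ∀ t k (g : Fin k → ℤ) → sumℤ k (λ i → signℤ t (g i)) ≡ signℤ t (sumℤ k g)
sumℤ-signℤ Sign.+ k g = refl
sumℤ-signℤ Sign.- k g = sumℤ-neg k g

≢⇒opposite : ∀ (s t : Sign) → s ≢ t → s ≡ Sign.opposite t
≢⇒opposite Sign.- Sign.- ne = ⊥-elim (ne refl)
≢⇒opposite Sign.- Sign.+ ne = refl
≢⇒opposite Sign.+ Sign.- ne = refl
≢⇒opposite Sign.+ Sign.+ ne = ⊥-elim (ne refl)

opposite-swap : ∀ s t → s ≡ Sign.opposite t → t ≡ Sign.opposite s
opposite-swap s t eq = sym (SignP.opposite-selfInverse (sym eq))

boundary : (G : SignedGraph) → (HalfEdge G → Sign) → (Fin (m G) → ℤ) → Fin (n G) → ℤ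
boundary G τ f v = sumℤ (m G) (λ e → contrib G τ f v (e , false) + contrib G τ f v (e , true))

module _ (G : SignedGraph) (τ : HalfEdge G → Sign) where

  contrib-+ : ∀ (f g : Fin (m G) → ℤ) v h →
              contrib G τ (λ e → f e + g e) v h ≡ contrib G τ f v h + contrib G τ g v h
  contrib-+ f g v h with does (attach G h ≟ v)
  ... | true  = signℤ-+ (τ h) (f (proj₁ h)) (g (proj₁ h))
  ... | false = refl

  contrib-neg : ∀ (f : Fin (m G) → ℤ) v h → contrib G τ (λ e → - f e) v h ≡ - contrib G τ f v h
  contrib-neg f v h with does (attach G h ≟ v)
  ... | true  = signℤ-neg (τ h) (f (proj₁ h))
  ... | false = refl

  contrib-scale : ∀ a (f : Fin (m G) → ℤ) v h →
                  contrib G τ (λ e → a * f e) v h ≡ a * contrib G τ f v h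
  contrib-scale a f v h with does (attach G h ≟ v)
  ... | true  = signℤ-scale (τ h) a (f (proj₁ h))
  ... | false = sym (*-zeroʳ a)

  contrib-ext : ∀ (f g : Fin (m G) → ℤ) → (∀ e → f e ≡ g e) → ∀ v h →
                contrib G τ f v h ≡ contrib G τ g v h
  contrib-ext f g eq v h with does (attach G h ≟ v)
  ... | true  = cong (signℤ (τ h)) (eq (proj₁ h))
  ... | false = refl

  contrib-0 : ∀ (f : Fin (m G) → ℤ) v h → f (proj₁ h) ≡ 0ℤ → contrib G τ f v h ≡ 0ℤ
  contrib-0 f v h eq with does (attach G h ≟ v)
  ... | true  = trans (cong (signℤ (τ h)) eq) (signℤ-0 (τ h))
  ... | false = refl

  boundary-+ : ∀ (f g : Fin (m G) → ℤ) v →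
               boundary G τ (λ e → f e + g e) v ≡ boundary G τ f v + boundary G τ g v
  boundary-+ f g v = trans (sumℤ-ext (m G) (λ e →
      trans (cong₂ _+_ (contrib-+ f g v (e , false)) (contrib-+ f g v (e , true)))
            (interchange (contrib G τ f v (e , false)) (contrib G τ g v (e , false))
                         (contrib G τ f v (e , true)) (contrib G τ g v (e , true)))))
    (sumℤ-+ (m G) _ _)

  boundary-neg : ∀ (f : Fin (m G) → ℤ) v → boundary G τ (λ e → - f e) v ≡ - boundary G τ f v
  boundary-neg f v = trans (sumℤ-ext (m G) (λ e →
      trans (cong₂ _+_ (contrib-neg f v (e , false)) (contrib-neg f v (e , true)))
            (sym (neg-distrib-+ (contrib G τ f v (e , false)) (contrib G τ f v (e , true))))))
    (sumℤ-neg (m G) _)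

  boundary-scale : ∀ a (f : Fin (m G) → ℤ) v →
                   boundary G τ (λ e → a * f e) v ≡ a * boundary G τ f v
  boundary-scale a f v = trans (sumℤ-ext (m G) (λ e →
      trans (cong₂ _+_ (contrib-scale a f v (e , false)) (contrib-scale a f v (e , true)))
            (sym (*-distribˡ-+ a _ _))))
    (sumℤ-scale a (m G) _)

  boundary-ext : ∀ (f g : Fin (m G) → ℤ) → (∀ e → f e ≡ g e) → ∀ v →
                 boundary G τ f v ≡ boundary G τ g v
  boundary-ext f g eq v = sumℤ-ext (m G) (λ e →
    cong₂ _+_ (contrib-ext f g eq v (e , false)) (contrib-ext f g eq v (e , true)))

  boundary-zero : ∀ v → boundary G τ (λ _ → 0ℤ) v ≡ 0ℤ
  boundary-zero v = sumℤ-zero (m G) _ (λ e →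
    cong₂ _+_ (contrib-0 (λ _ → 0ℤ) v (e , false) refl) (contrib-0 (λ _ → 0ℤ) v (e , true) refl))

  boundary-difference : ∀ (f g : Fin (m G) → ℤ) → (∀ v → boundary G τ f v ≡ 0ℤ) →
               (∀ v → boundary G τ g v ≡ 0ℤ) → ∀ v → boundary G τ (λ e → f e - g e) v ≡ 0ℤ
  boundary-difference f g ∂f ∂g v = trans (boundary-+ f (λ e → - g e) v)
    (cong₂ _+_ (∂f v) (trans (boundary-neg g v) (cong -_ (∂g v))))

reorient : (G : SignedGraph) → (HalfEdge G → Sign) → (Fin (m G) → Sign) → HalfEdge G → Sign
reorient G τ ρ h = τ h Sign.* ρ (proj₁ h)

reorient-orientation : ∀ G τ ρ → IsOrientation G τ → IsOrientation G (reorient G τ ρ)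
reorient-orientation G τ ρ o e = trans (switch (τ (e , false)) (τ (e , true)) (ρ e)) (o e)
  where
  switch : ∀ a b r → (a Sign.* r) Sign.* (b Sign.* r) ≡ a Sign.* b
  switch Sign.- Sign.- Sign.- = refl
  switch Sign.- Sign.- Sign.+ = refl
  switch Sign.- Sign.+ Sign.- = refl
  switch Sign.- Sign.+ Sign.+ = refl
  switch Sign.+ Sign.- Sign.- = refl
  switch Sign.+ Sign.- Sign.+ = refl
  switch Sign.+ Sign.+ Sign.- = refl
  switch Sign.+ Sign.+ Sign.+ = refl

reorient-boundary : ∀ G τ ρ (f : Fin (m G) → ℤ) v →
                    boundary G (reorient G τ ρ) (λ e → signℤ (ρ e) (f e)) v ≡ boundary G τ f v
reorient-boundary G τ ρ f v = sumℤ-ext (m G) (λ e →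
  cong₂ _+_ (reorient-contrib (e , false)) (reorient-contrib (e , true)))
  where
  cancel : ∀ a r x → signℤ (a Sign.* r) (signℤ r x) ≡ signℤ a x
  cancel a r x = trans (signℤ-* (a Sign.* r) r x)
    (cong (λ t → signℤ t x) (trans (SignP.*-assoc a r r) (trans (cong (a Sign.*_) (SignP.s*s≡+ r))
      (SignP.*-identityʳ a))))
  reorient-contrib : ∀ h → contrib G (reorient G τ ρ) (λ e → signℤ (ρ e) (f e)) v h ≡ contrib G τ f v h
  reorient-contrib h with does (attach G h ≟ v)
  ... | true  = cancel (τ h) (ρ (proj₁ h)) (f (proj₁ h))
  ... | false = refl

-- Walks that follow the flow.  A half-edge h of e is read as "e traversed starting at
-- attach h"; flipHalf h is the other half of e, sitting at the far end.

flipHalf : {G : SignedGraph} → HalfEdge G → HalfEdge G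
flipHalf (e , b) = (e , not b)

flipHalf-involutive : ∀ {G} (h : HalfEdge G) → flipHalf {G} (flipHalf {G} h) ≡ h
flipHalf-involutive (e , false) = refl
flipHalf-involutive (e , true)  = refl

same-edge : ∀ {G} (h h' : HalfEdge G) → proj₁ h ≡ proj₁ h' → h' ≡ h ⊎ h' ≡ flipHalf {G} h
same-edge (e , false) (.e , false) refl = inj₁ refl
same-edge (e , false) (.e , true)  refl = inj₂ refl
same-edge (e , true)  (.e , false) refl = inj₂ refl
same-edge (e , true)  (.e , true)  refl = inj₁ refl

ends-joins : ∀ (G : SignedGraph) (h : HalfEdge G) →
             Joins G (proj₁ h) (attach G h) (attach G (flipHalf {G} h))
ends-joins G (e , false) = inj₁ refl
ends-joins G (e , true)  = inj₂ refl

-- h' continues h: it starts where h ends, and a flow entering along h may leave along h'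
-- (the contributions of flipHalf h and h' at that vertex have opposite signs).
Continues : (G : SignedGraph) → (HalfEdge G → Sign) → HalfEdge G → HalfEdge G → Set
Continues G τ h h' = attach G h' ≡ attach G (flipHalf {G} h) × τ h' ≡ Sign.opposite (τ (flipHalf {G} h))

UnitFlowIn : (G : SignedGraph) → (HalfEdge G → Sign) → (Fin (m G) → Set) → Set
UnitFlowIn G τ S = Σ (Fin (m G) → ℤ) λ c →
  (∀ v → boundary G τ c v ≡ 0ℤ) × (∀ e → c e ≡ 0ℤ ⊎ c e ≡ 1ℤ) × (∀ e → c e ≡ 1ℤ → S e) ×
  Σ (Fin (m G)) (λ e → c e ≡ 1ℤ)

flipN : ℕ → Sign → Sign
flipN zero    t = t
flipN (suc k) t = Sign.opposite (flipN k t)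

flipN-+ : ∀ p q t → flipN (p ℕ.+ q) t ≡ flipN p (flipN q t)
flipN-+ zero    q t = refl
flipN-+ (suc p) q t = cong Sign.opposite (flipN-+ p q t)

sign-*-flipN : ∀ σ t → σ Sign.* t ≡ flipN (isNeg σ) t
sign-*-flipN Sign.- t = refl
sign-*-flipN Sign.+ t = refl

flipN-odd : ∀ k t → flipN k t ≡ Sign.opposite t → k % 2 ≡ 1
flipN-odd zero          t eq = ⊥-elim (SignP.s≢opposite[s] t eq)
flipN-odd (suc zero)    t eq = refl
flipN-odd (suc (suc k)) t eq =
  flipN-odd k t (trans (sym (SignP.opposite-involutive (flipN k t))) eq)

next-cases : ∀ {l} (i : Fin (suc l)) →
             (toℕ i < l × toℕ (next i) ≡ suc (toℕ i)) ⊎ (toℕ i ≡ l × toℕ (next i) ≡ 0)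
next-cases {zero}  zero = inj₂ (refl , refl)
next-cases {suc l} zero = inj₁ (s≤s z≤n , refl)
next-cases {suc l} (suc i) with next {l} i | next-cases {l} i
... | zero  | inj₁ (_ , ())
... | zero  | inj₂ (eq , _) = inj₂ (cong suc eq , refl)
... | suc j | inj₁ (lt , eq) = inj₁ (s≤s lt , cong suc eq)
... | suc j | inj₂ (_ , ())

steps : ℕ → ℕ → List ℕ
steps a zero    = []
steps a (suc L) = a ∷ steps (suc a) L

steps-range : ∀ {a L k} → k ∈ steps a L → a ≤ k × k < a ℕ.+ L
steps-range {a} {suc L} (here refl) = ℕP.≤-refl , ℕP.m<m+n a (s≤s z≤n)
steps-range {a} {suc L} {k} (there p) with steps-range {suc a} {L} p
... | (le , lt) = ℕP.<⇒≤ le , subst (k <_) (sym (ℕP.+-suc a L)) lt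

Increasing : List ℕ → Set
Increasing []      = ⊤
Increasing (k ∷ P) = All (k <_) P × Increasing P

steps-increasing : ∀ a L → Increasing (steps a L)
steps-increasing a zero    = _
steps-increasing a (suc L) = All.tabulate (λ p → proj₁ (steps-range p)) , steps-increasing (suc a) L

++-increasing : ∀ P Q → Increasing P → Increasing Q → (∀ {k l} → k ∈ P → l ∈ Q → k < l) →
                Increasing (P ++ Q)
++-increasing []      Q _        iq _ = iq
++-increasing (k ∷ P) Q (a , ip) iq H =
  AllP.++⁺ a (All.tabulate (λ q → H (here refl) q)) , ++-increasing P Q ip iq (λ p q → H (there p) q)

module Walk (G : SignedGraph) (τ : HalfEdge G → Sign) (τo : IsOrientation G τ)
            (S : Fin (m G) → Set)
            (W : ℕ → HalfEdge G) (W∈S : ∀ k → S (proj₁ (W k)))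
            (cont : ∀ k → Continues G τ (W k) (W (suc k))) where

  x : ℕ → Fin (n G)
  x k = attach G (W k)

  s : ℕ → Sign
  s k = τ (W k)

  ed : ℕ → Fin (m G)
  ed k = proj₁ (W k)

  far-end : ∀ k → attach G (flipHalf {G} (W k)) ≡ x (suc k)
  far-end k = sym (proj₁ (cont k))

  far-sign : ∀ k → τ (flipHalf {G} (W k)) ≡ Sign.opposite (s (suc k))
  far-sign k = opposite-swap (s (suc k)) (τ (flipHalf {G} (W k))) (proj₂ (cont k))

  step-joins : ∀ k → Joins G (ed k) (x k) (x (suc k))
  step-joins k = subst (Joins G (ed k) (x k)) (far-end k) (ends-joins G (W k))

  sign-step : ∀ k → s (suc k) ≡ σ G (ed k) Sign.* s k
  sign-step k = solve (s k) (s (suc k)) (σ G (ed k))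
    (trans (cong (s k Sign.*_) (sym (far-sign k))) (orient (W k)))
    where
    orient : ∀ h → τ h Sign.* τ (flipHalf {G} h) ≡ Sign.opposite (σ G (proj₁ h))
    orient (e , false) = τo e
    orient (e , true)  = trans (SignP.*-comm (τ (e , true)) (τ (e , false))) (τo e)
    solve : ∀ a b σ → a Sign.* Sign.opposite b ≡ Sign.opposite σ → b ≡ σ Sign.* a
    solve Sign.- Sign.- Sign.- ()
    solve Sign.- Sign.- Sign.+ eq = refl
    solve Sign.- Sign.+ Sign.- eq = refl
    solve Sign.- Sign.+ Sign.+ ()
    solve Sign.+ Sign.- Sign.- eq = refl
    solve Sign.+ Sign.- Sign.+ ()
    solve Sign.+ Sign.+ Sign.- ()
    solve Sign.+ Sign.+ Sign.+ eq = refl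

  negatives : ℕ → ℕ → ℕ
  negatives a zero    = 0
  negatives a (suc L) = isNeg (σ G (ed a)) ℕ.+ negatives (suc a) L

  sign-after : ∀ a L → s (a ℕ.+ L) ≡ flipN (negatives a L) (s a)
  sign-after a zero    = cong s (ℕP.+-identityʳ a)
  sign-after a (suc L) = begin
    s (a ℕ.+ suc L)                                  ≡⟨ cong s (ℕP.+-suc a L) ⟩
    s (suc a ℕ.+ L)                                  ≡⟨ sign-after (suc a) L ⟩
    flipN N (s (suc a))                              ≡⟨ cong (flipN N) (trans (sign-step a) (sign-*-flipN σa (s a))) ⟩
    flipN N (flipN (isNeg σa) (s a))                 ≡⟨ sym (flipN-+ N _ (s a)) ⟩
    flipN (N ℕ.+ isNeg σa) (s a)                     ≡⟨ cong (λ z → flipN z (s a)) (ℕP.+-comm N _) ⟩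
    flipN (negatives a (suc L)) (s a)                ∎
    where
    open ≡-Reasoning
    N : ℕ
    N = negatives (suc a) L
    σa : Sign
    σa = σ G (ed a)

  negatives-sum : ∀ a L → sumℕ L (λ i → isNeg (σ G (ed (a ℕ.+ toℕ i)))) ≡ negatives a L
  negatives-sum a zero    = refl
  negatives-sum a (suc L) = cong₂ ℕ._+_ (cong (λ z → isNeg (σ G (ed z))) (ℕP.+-identityʳ a))
    (trans (sumℕ-ext L (λ i → cong (λ z → isNeg (σ G (ed z))) (ℕP.+-suc a (toℕ i))))
           (negatives-sum (suc a) L))

  record Reversed (k l : ℕ) : Set where
    field
      tail≡head : x l ≡ x (suc k)
      tail-sign : s l ≡ Sign.opposite (s (suc k))
      head≡tail : x (suc l) ≡ x k
      head-sign : s (suc l) ≡ Sign.opposite (s k)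

  same-edge-steps : ∀ k l → ed k ≡ ed l → (x l ≡ x k × s l ≡ s k) ⊎ Reversed k l
  same-edge-steps k l eq with same-edge {G} (W k) (W l) eq
  ... | inj₁ p = inj₁ (cong (attach G) p , cong τ p)
  ... | inj₂ p = inj₂ (record
    { tail≡head = trans (cong (attach G) p) (far-end k)
    ; tail-sign = trans (cong τ p) (far-sign k)
    ; head≡tail = trans (sym (far-end l))
        (trans (cong (λ h → attach G (flipHalf {G} h)) p) (cong (attach G) (flipHalf-involutive {G} (W k))))
    ; head-sign = opposite-swap _ _ (trans (sym (trans (cong (λ h → τ (flipHalf {G} h)) p)
        (cong τ (flipHalf-involutive {G} (W k))))) (far-sign l)) })

  point : Fin (n G) → Sign → Fin (n G) → ℤ
  point a t v = if does (a ≟ v) then signℤ t 1ℤ else 0ℤ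

  point-opposite : ∀ a t v → point a (Sign.opposite t) v ≡ - point a t v
  point-opposite a t v with does (a ≟ v)
  ... | true  = signℤ-opposite t 1ℤ
  ... | false = refl

  ι : ℕ → Fin (n G) → ℤ
  ι k = point (x k) (s k)

  ι-cong : ∀ k l v → x k ≡ x l → s k ≡ s l → ι k v ≡ ι l v
  ι-cong k l v p q = cong₂ (λ a t → point a t v) p q

  ι-opposite : ∀ k l v → x k ≡ x l → s k ≡ Sign.opposite (s l) → ι k v ≡ - ι l v
  ι-opposite k l v p q = trans (cong₂ (λ a t → point a t v) p q) (point-opposite (x l) (s l) v)

  indicator : ℕ → Fin (m G) → ℤ
  indicator k e = if does (ed k ≟ e) then 1ℤ else 0ℤ

  indicator-self : ∀ k → indicator k (ed k) ≡ 1ℤ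
  indicator-self k with ed k ≟ ed k
  ... | yes _ = refl
  ... | no ne = ⊥-elim (ne refl)

  indicator-other : ∀ k e → ed k ≢ e → indicator k e ≡ 0ℤ
  indicator-other k e ne with ed k ≟ e
  ... | yes p = ⊥-elim (ne p)
  ... | no _  = refl

  boundary-indicator : ∀ k v → boundary G τ (indicator k) v ≡ ι k v - ι (suc k) v
  boundary-indicator k v = begin
    boundary G τ (indicator k) v
      ≡⟨ sumℤ-single (m G) _ (ed k) (λ e ne →
           cong₂ _+_ (contrib-0 G τ (indicator k) v (e , false) (indicator-other k e (λ p → ne (sym p))))
                     (contrib-0 G τ (indicator k) v (e , true) (indicator-other k e (λ p → ne (sym p))))) ⟩
    contrib G τ (indicator k) v (ed k , false) + contrib G τ (indicator k) v (ed k , true)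
      ≡⟨ cong₂ _+_ (unit (ed k , false) (indicator-self k)) (unit (ed k , true) (indicator-self k)) ⟩
    ιʰ (ed k , false) + ιʰ (ed k , true)
      ≡⟨ both-halves (W k) ⟩
    ι k v + ιʰ (flipHalf {G} (W k))
      ≡⟨ cong (ι k v +_) (trans (cong₂ (λ a t → point a t v) (far-end k) (far-sign k))
                                 (point-opposite (x (suc k)) (s (suc k)) v)) ⟩
    ι k v - ι (suc k) v ∎
    where
    open ≡-Reasoning
    ιʰ : HalfEdge G → ℤ
    ιʰ h = point (attach G h) (τ h) v
    unit : ∀ h → indicator k (proj₁ h) ≡ 1ℤ → contrib G τ (indicator k) v h ≡ ιʰ h
    unit h eq with does (attach G h ≟ v)
    ... | true  = cong (signℤ (τ h)) eq
    ... | false = refl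
    both-halves : ∀ h → ιʰ (proj₁ h , false) + ιʰ (proj₁ h , true) ≡ ιʰ h + ιʰ (flipHalf {G} h)
    both-halves (e , false) = refl
    both-halves (e , true)  = +-comm (ιʰ (e , false)) (ιʰ (e , true))

  usage : List ℕ → Fin (m G) → ℤ
  usage []      e = 0ℤ
  usage (k ∷ P) e = indicator k e + usage P e

  net : List ℕ → Fin (n G) → ℤ
  net []      v = 0ℤ
  net (k ∷ P) v = (ι k v - ι (suc k) v) + net P v

  boundary-usage : ∀ P v → boundary G τ (usage P) v ≡ net P v
  boundary-usage []      v = boundary-zero G τ v
  boundary-usage (k ∷ P) v = trans (boundary-+ G τ (indicator k) (usage P) v)
    (cong₂ _+_ (boundary-indicator k v) (boundary-usage P v))

  net-++ : ∀ P Q v → net (P ++ Q) v ≡ net P v + net Q v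
  net-++ []      Q v = sym (+-identityˡ _)
  net-++ (k ∷ P) Q v = trans (cong ((ι k v - ι (suc k) v) +_) (net-++ P Q v))
    (sym (+-assoc (ι k v - ι (suc k) v) (net P v) (net Q v)))

  net-steps : ∀ a L v → net (steps a L) v ≡ ι a v - ι (a ℕ.+ L) v
  net-steps a zero    v rewrite ℕP.+-identityʳ a = sym (+-inverseʳ (ι a v))
  net-steps a (suc L) v rewrite ℕP.+-suc a L =
    trans (cong ((ι a v - ι (suc a) v) +_) (net-steps (suc a) L v))
          (telescope (ι a v) (ι (suc a) v) (ι (suc a ℕ.+ L) v))
    where
    telescope : ∀ (A B C : ℤ) → (A - B) + (B - C) ≡ A - C
    telescope = solve-∀

  EdgeDistinct : List ℕ → Set
  EdgeDistinct []      = ⊤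
  EdgeDistinct (k ∷ P) = All (λ l → ed k ≢ ed l) P × EdgeDistinct P

  edge-distinct : ∀ P → Increasing P → (∀ {k l} → k ∈ P → l ∈ P → ed k ≡ ed l → k ≡ l) →
                  EdgeDistinct P
  edge-distinct []      _        _   = _
  edge-distinct (k ∷ P) (a , inc) ed≡ =
    All.tabulate (λ {l} mem eq → ℕP.<-irrefl (ed≡ (here refl) (there mem) eq) (All.lookup a mem)) ,
    edge-distinct P inc (λ p q → ed≡ (there p) (there q))

  usage-miss : ∀ P e → All (λ l → ed l ≢ e) P → usage P e ≡ 0ℤ
  usage-miss []      e _        = refl
  usage-miss (k ∷ P) e (ne ∷ a) = cong₂ _+_ (indicator-other k e ne) (usage-miss P e a)

  usage-01 : ∀ P → EdgeDistinct P → ∀ e → usage P e ≡ 0ℤ ⊎ usage P e ≡ 1ℤ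
  usage-01 []      _       e = inj₁ refl
  usage-01 (k ∷ P) (a , d) e with ed k ≟ e
  ... | yes refl = inj₂ (cong (1ℤ +_) (usage-miss P (ed k) (All.map (λ ne p → ne (sym p)) a)))
  ... | no _ with usage-01 P d e
  ...   | inj₁ p = inj₁ (trans (+-identityˡ _) p)
  ...   | inj₂ p = inj₂ (trans (+-identityˡ _) p)

  usage-support : ∀ P e → usage P e ≡ 1ℤ → Σ ℕ λ k → k ∈ P × ed k ≡ e
  usage-support []      e ()
  usage-support (k ∷ P) e eq with ed k ≟ e
  ... | yes p = k , here refl , p
  ... | no _ with usage-support P e (trans (sym (+-identityˡ _)) eq)
  ...   | (l , mem , p) = l , there mem , p

  usage-hit : ∀ P → EdgeDistinct P → ∀ {k} → k ∈ P → usage P (ed k) ≡ 1ℤ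
  usage-hit (k ∷ P) (a , d) (here refl) =
    trans (cong₂ _+_ (indicator-self k) (usage-miss P (ed k) (All.map (λ ne p → ne (sym p)) a))) refl
  usage-hit (k' ∷ P) (a , d) {k} (there mem) =
    trans (cong₂ _+_ (indicator-other k' (ed k) (All.lookup a mem)) (usage-hit P d mem)) refl

  unit-flow : ∀ P → EdgeDistinct P → (∀ v → net P v ≡ 0ℤ) → ∀ {k₀} → k₀ ∈ P → UnitFlowIn G τ S
  unit-flow P dist closed {k₀} mem = usage P , (λ v → trans (boundary-usage P v) (closed v)) ,
    usage-01 P dist ,
    (λ e eq → let (k , _ , edk) = usage-support P e eq in subst S edk (W∈S k)) ,
    (ed k₀ , usage-hit P dist mem)

  VertexDistinct : ℕ → ℕ → Set
  VertexDistinct a b = ∀ k l → a ≤ k → k < b → a ≤ l → l < b → x k ≡ x l → k ≡ l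

  s≢opposite-s : ∀ {k l} → k ≡ l → s k ≡ Sign.opposite (s l) → ⊥
  s≢opposite-s {k} refl eq = SignP.s≢opposite[s] (s k) eq

  -- A closed segment a … b with distinct vertices uses distinct edges: a reversed edge
  -- would force a repeated vertex, except for a 2-cycle, where the signs disagree.
  closed-segment-edge-distinct : ∀ a b → VertexDistinct a b → x b ≡ x a →
    ∀ k l → a ≤ k → k < b → a ≤ l → l < b → ed k ≡ ed l → k ≡ l
  closed-segment-edge-distinct a b D closed k l ak kb al lb eq with same-edge-steps k l eq
  ... | inj₁ (px , _) = sym (D l k al lb ak kb px)
  ... | inj₂ R = reversed (ℕP.m≤n⇒m<n∨m≡n kb)
    where
    open Reversed R
    a<b : a < b
    a<b = ℕP.≤-<-trans ak kb
    reversed : suc k < b ⊎ suc k ≡ b → k ≡ l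
    reversed (inj₁ sk<b) =
      ⊥-elim (s≢opposite-s (D l (suc k) al lb (ℕP.m≤n⇒m≤1+n ak) sk<b tail≡head) tail-sign)
    reversed (inj₂ sk≡b) = two-cycle (ℕP.m≤n⇒m<n∨m≡n a<b)
      where
      l≡a : l ≡ a
      l≡a = D l a al lb ℕP.≤-refl a<b (trans tail≡head (trans (cong x sk≡b) closed))
      two-cycle : suc a < b ⊎ suc a ≡ b → k ≡ l
      two-cycle (inj₁ sa<b) = ⊥-elim (s≢opposite-s (cong suc l≡a)
        (subst (λ z → s (suc l) ≡ Sign.opposite (s z)) (sym sa≡k) head-sign))
        where
        sa≡k : suc a ≡ k
        sa≡k = D (suc a) k (ℕP.m≤n⇒m≤1+n ℕP.≤-refl) sa<b ak kb
                 (subst (λ z → x (suc z) ≡ x k) l≡a head≡tail)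
      two-cycle (inj₂ sa≡b) =
        trans (ℕP.≤-antisym (ℕP.≤-pred (subst (suc k ≤_) (sym sa≡b) kb)) ak) (sym l≡a)

  balanced-segment : ∀ a d → VertexDistinct a (a ℕ.+ suc d) →
    x (a ℕ.+ suc d) ≡ x a → s (a ℕ.+ suc d) ≡ s a → UnitFlowIn G τ S
  balanced-segment a d D closed same-sign = unit-flow (steps a (suc d))
    (edge-distinct (steps a (suc d)) (steps-increasing a (suc d)) (λ p q eq →
       let (ak , kb) = steps-range p ; (al , lb) = steps-range q in
       closed-segment-edge-distinct a (a ℕ.+ suc d) D closed _ _ ak kb al lb eq))
    (λ v → trans (net-steps a (suc d) v)
      (trans (cong (λ z → ι a v - z) (ι-cong (a ℕ.+ suc d) a v closed same-sign)) (+-inverseʳ (ι a v))))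
    (here refl)

  module SegmentCircuit (a d : ℕ) (D : VertexDistinct a (a ℕ.+ suc d)) (closed : x (a ℕ.+ suc d) ≡ x a) where
    idx : Fin (suc d) → ℕ
    idx i = a ℕ.+ toℕ i

    idx-lo : ∀ i → a ≤ idx i
    idx-lo i = ℕP.m≤m+n a (toℕ i)

    idx-hi : ∀ i → idx i < a ℕ.+ suc d
    idx-hi i = ℕP.+-monoʳ-< a (FinP.toℕ<n i)

    circuit : Circuit G
    circuit = record
      { l = d
      ; w = λ i → x (idx i)
      ; c = λ i → ed (idx i)
      ; w-inj = λ {i} {j} eq → FinP.toℕ-injective (ℕP.+-cancelˡ-≡ a _ _
                  (D (idx i) (idx j) (idx-lo i) (idx-hi i) (idx-lo j) (idx-hi j) eq))
      ; c-inj = λ {i} {j} eq → FinP.toℕ-injective (ℕP.+-cancelˡ-≡ a _ _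
                  (closed-segment-edge-distinct a (a ℕ.+ suc d) D closed
                     (idx i) (idx j) (idx-lo i) (idx-hi i) (idx-lo j) (idx-hi j) eq))
      ; joins = λ i → subst (Joins G (ed (idx i)) (x (idx i))) (next-vertex i) (step-joins (idx i))
      }
      where
      next-vertex : ∀ i → x (suc (idx i)) ≡ x (idx (next i))
      next-vertex i with next-cases i
      ... | inj₁ (_ , eq) = cong x (trans (sym (ℕP.+-suc a (toℕ i))) (cong (a ℕ.+_) (sym eq)))
      ... | inj₂ (eq1 , eq2) =
        trans (cong x (trans (sym (ℕP.+-suc a (toℕ i))) (cong (λ z → a ℕ.+ suc z) eq1)))
              (trans closed (cong x (trans (sym (ℕP.+-identityʳ a)) (cong (a ℕ.+_) (sym eq2)))))

    unbalanced : s (a ℕ.+ suc d) ≡ Sign.opposite (s a) → Unbalanced {G} circuit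
    unbalanced eq = subst (λ z → z % 2 ≡ 1) (sym (negatives-sum a (suc d)))
      (flipN-odd (negatives a (suc d)) (s a) (trans (sym (sign-after a (suc d))) eq))

    on-circuit⁻ : ∀ {v} → OnCircuit {G} v circuit → Σ ℕ λ k → a ≤ k × k < a ℕ.+ suc d × x k ≡ v
    on-circuit⁻ (i , eq) = idx i , idx-lo i , idx-hi i , eq

  module SegmentPath (a len : ℕ)
         (D : ∀ k l → a ≤ k → k ≤ a ℕ.+ len → a ≤ l → l ≤ a ℕ.+ len → x k ≡ x l → k ≡ l) where
    path : Path G
    path = record
      { len = len
      ; p = λ t → x (a ℕ.+ toℕ t)
      ; q = λ t → ed (a ℕ.+ toℕ t)
      ; p-inj = λ {i} {j} eq → FinP.toℕ-injective (ℕP.+-cancelˡ-≡ a _ _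
           (D (a ℕ.+ toℕ i) (a ℕ.+ toℕ j) (ℕP.m≤m+n a _) (ℕP.+-monoʳ-≤ a (ℕP.≤-pred (FinP.toℕ<n i)))
              (ℕP.m≤m+n a _) (ℕP.+-monoʳ-≤ a (ℕP.≤-pred (FinP.toℕ<n j))) eq))
      ; joins = λ t → subst₂ (Joins G (ed (a ℕ.+ toℕ t)))
           (cong (λ z → x (a ℕ.+ z)) (sym (FinP.toℕ-inject₁ t)))
           (cong x (sym (ℕP.+-suc a (toℕ t))))
           (step-joins (a ℕ.+ toℕ t))
      }

-- First stop of a sequence in a finite set: for y : ℕ → Fin N and a decidable target T,
-- there is q ≥ 1 such that y 1, …, y (q-1) are distinct and avoid T, while y q lies in T
-- or repeats one of them.  (Pigeonhole bounds the search by N + 1 steps.)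
record FirstStop (N : ℕ) (y : ℕ → Fin N) (T : Fin N → Set) : Set where
  field
    q      : ℕ
    q≥1    : 1 ≤ q
    dist   : ∀ k l → 1 ≤ k → k < q → 1 ≤ l → l < q → y k ≡ y l → k ≡ l
    avoids : ∀ k → 1 ≤ k → k < q → ¬ T (y k)
    stop   : T (y q) ⊎ Σ ℕ λ r → 1 ≤ r × r < q × y q ≡ y r

module _ (N : ℕ) (y : ℕ → Fin N) (T : Fin N → Set) (T? : ∀ v → Dec (T v)) where

  private
    Distinct : ℕ → Set
    Distinct q = ∀ k l → 1 ≤ k → k < q → 1 ≤ l → l < q → y k ≡ y l → k ≡ l

    Avoids : ℕ → Set
    Avoids q = ∀ k → 1 ≤ k → k < q → ¬ T (y k)

    below-or-at : ∀ {k q} → k < suc q → k < q ⊎ k ≡ q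
    below-or-at lt = ℕP.m≤n⇒m<n∨m≡n (ℕP.≤-pred lt)

    -- Extend the distinct, T-avoiding prefix 1 … q-1 until it stops; fuel counts the
    -- remaining room before the pigeonhole principle is violated.
    extend : ∀ q fuel → 1 ≤ q → suc (suc N) ≤ q ℕ.+ fuel → Distinct q → Avoids q → FirstStop N y T
    extend q zero q≥1 big dist _ = ⊥-elim (no-collision (FinP.pigeonhole (ℕP.n<1+n N) y′))
      where
      y′ : Fin (suc N) → Fin N
      y′ i = y (suc (toℕ i))
      bound : ∀ (i : Fin (suc N)) → suc (toℕ i) < q
      bound i = ℕP.<-≤-trans (s≤s (FinP.toℕ<n i)) (subst (suc (suc N) ≤_) (ℕP.+-identityʳ q) big)
      no-collision : (Σ (Fin (suc N)) λ i → Σ (Fin (suc N)) λ j → i Data.Fin.< j × y′ i ≡ y′ j) → ⊥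
      no-collision (i , j , i<j , eq) =
        ℕP.<-irrefl (ℕP.suc-injective (dist _ _ (s≤s z≤n) (bound i) (s≤s z≤n) (bound j) eq)) i<j
    extend q (suc fuel) q≥1 big dist avoids with T? (y q)
    ... | yes t = record { q = q ; q≥1 = q≥1 ; dist = dist ; avoids = avoids ; stop = inj₁ t }
    ... | no ¬t with ℕP.anyUpTo? (λ r → (1 ℕP.≤? r) ×-dec (y q ≟ y r)) q
    ...   | yes (r , r<q , 1≤r , eq) =
            record { q = q ; q≥1 = q≥1 ; dist = dist ; avoids = avoids ; stop = inj₂ (r , 1≤r , r<q , eq) }
    ...   | no ¬repeat = extend (suc q) fuel (ℕP.m≤n⇒m≤1+n q≥1)
            (subst (suc (suc N) ≤_) (ℕP.+-suc q fuel) big) dist′ avoids′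
      where
      dist′ : Distinct (suc q)
      dist′ k l k1 kq l1 lq eq with below-or-at kq | below-or-at lq
      ... | inj₁ k<q  | inj₁ l<q  = dist k l k1 k<q l1 l<q eq
      ... | inj₁ k<q  | inj₂ refl = ⊥-elim (¬repeat (k , k<q , k1 , sym eq))
      ... | inj₂ refl | inj₁ l<q  = ⊥-elim (¬repeat (l , l<q , l1 , eq))
      ... | inj₂ refl | inj₂ refl = refl
      avoids′ : Avoids (suc q)
      avoids′ k k1 kq with below-or-at kq
      ... | inj₁ k<q  = avoids k k1 k<q
      ... | inj₂ refl = ¬t

  first-stop : FirstStop N y T
  first-stop = extend 1 (suc N) ℕP.≤-refl ℕP.≤-refl
    (λ { k l (s≤s z≤n) (s≤s ()) _ _ _ }) (λ { k (s≤s z≤n) (s≤s ()) })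

gap : ∀ {r M} → r < M → Σ ℕ λ d → r ℕ.+ suc d ≡ M
gap {r} {M} lt = M ∸ suc r , trans (ℕP.+-suc r (M ∸ suc r)) (ℕP.m+[n∸m]≡n lt)

data Position (L k : ℕ) : Set where
  before : k < L → Position L k
  at     : k ≡ L → Position L k
  after  : L < k → Position L k

position : ∀ L k → Position L k
position L k with ℕP.<-cmp k L
... | tri< a _ _ = before a
... | tri≈ _ b _ = at b
... | tri> _ _ c = after c

-- The walk starts with an unbalanced circuit C = x 0 … x L
-- (x L = x 0, the sign reversed).  Follow the walk on from the junction x L until it stops
-- at C or at one of its own vertices, at step M.  Depending on where it stops and with
-- which sign, the steps used so far contain a balanced circuit, a short barbell or a theta
-- (each carrying a unit flow), or a long barbell, which is excluded.
module AfterUnbalancedCircuit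
    (G : SignedGraph) (τ : HalfEdge G → Sign) (τo : IsOrientation G τ) (noLB : ¬ LongBarbell G)
    (S : Fin (m G) → Set) (W : ℕ → HalfEdge G) (W∈S : ∀ k → S (proj₁ (W k)))
    (cont : ∀ k → Continues G τ (W k) (W (suc k))) (L₀ : ℕ) where

  open Walk G τ τo S W W∈S cont

  L : ℕ
  L = suc L₀

  module _ (C-distinct : VertexDistinct 0 L) (closed : x L ≡ x 0)
           (C-unbalanced : s L ≡ Sign.opposite (s 0)) where

    OnC : Fin (n G) → Set
    OnC v = Σ ℕ λ k → k < L × x k ≡ v

    tail : FirstStop (n G) (λ k → x (L ℕ.+ k)) OnC
    tail = first-stop (n G) (λ k → x (L ℕ.+ k)) OnC (λ v → ℕP.anyUpTo? (λ k → x k ≟ v) L)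

    open FirstStop tail renaming (q to T)

    M : ℕ
    M = L ℕ.+ T

    L<M : L < M
    L<M = ℕP.m<m+n L q≥1

    L<L+ : ∀ r → 1 ≤ r → L < L ℕ.+ r
    L<L+ r r≥1 = subst (_< L ℕ.+ r) (ℕP.+-identityʳ L) (ℕP.+-monoʳ-< L r≥1)

    in-tail : ∀ k → L < k → k < M → 1 ≤ k ∸ L × k ∸ L < T × L ℕ.+ (k ∸ L) ≡ k
    in-tail k Lk kM = offset≥1 , offset<T , back
      where
      back : L ℕ.+ (k ∸ L) ≡ k
      back = ℕP.m+[n∸m]≡n (ℕP.<⇒≤ Lk)
      offset≥1 : 1 ≤ k ∸ L
      offset≥1 = ℕP.m<n⇒0<n∸m Lk
      offset<T : k ∸ L < T
      offset<T = ℕP.+-cancelˡ-< L _ _ (subst (_< M) (sym back) kM)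

    tail-distinct : ∀ k l → L < k → k < M → L < l → l < M → x k ≡ x l → k ≡ l
    tail-distinct k l Lk kM Ll lM eq with in-tail k Lk kM | in-tail l Ll lM
    ... | (k1 , kT , ke) | (l1 , lT , le) = trans (sym ke) (trans (cong (L ℕ.+_)
          (dist _ _ k1 kT l1 lT (trans (cong x ke) (trans eq (sym (cong x le)))))) le)

    tail-avoids-C : ∀ k → L < k → k < M → ¬ OnC (x k)
    tail-avoids-C k Lk kM oc with in-tail k Lk kM
    ... | (k1 , kT , ke) = avoids _ k1 kT (subst OnC (cong x (sym ke)) oc)

    C-tail-disjoint : ∀ k l → k < L → L < l → l < M → x k ≢ x l
    C-tail-disjoint k l kL Ll lM eq = tail-avoids-C l Ll lM (k , kL , eq)

    junction-not-in-tail : ∀ l → L < l → l < M → x L ≢ x l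
    junction-not-in-tail l Ll lM eq = tail-avoids-C l Ll lM (0 , s≤s z≤n , trans (sym closed) eq)

    junction-in-C : ∀ k → k < L → x L ≡ x k → k ≡ 0
    junction-in-C k kL eq = C-distinct k 0 z≤n kL z≤n (s≤s z≤n) (trans (sym eq) closed)

    junction-tail-distinct : ∀ b → b ≤ M → VertexDistinct L b
    junction-tail-distinct b bM k l Lk kb Ll lb eq with position L k | position L l
    ... | before a  | _         = ⊥-elim (ℕP.<⇒≱ a Lk)
    ... | _         | before a  = ⊥-elim (ℕP.<⇒≱ a Ll)
    ... | at refl   | at refl   = refl
    ... | at refl   | after a   = ⊥-elim (junction-not-in-tail l a (ℕP.<-≤-trans lb bM) eq)
    ... | after a   | at refl   = ⊥-elim (junction-not-in-tail k a (ℕP.<-≤-trans kb bM) (sym eq))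
    ... | after a   | after a'  = tail-distinct k l a (ℕP.<-≤-trans kb bM) a' (ℕP.<-≤-trans lb bM) eq

    step-determined : ∀ k l → k < M → l < M → x l ≡ x k → s l ≡ s k → k ≡ l
    step-determined k l kM lM ex es with position L k | position L l
    ... | before a | before b = C-distinct k l z≤n a z≤n b (sym ex)
    ... | before a | at refl  = ⊥-elim (SignP.s≢opposite[s] (s 0)
          (trans (sym (trans es (cong s (junction-in-C k a ex)))) C-unbalanced))
    ... | before a | after b  = ⊥-elim (C-tail-disjoint k l a b lM (sym ex))
    ... | at refl  | before b = ⊥-elim (SignP.s≢opposite[s] (s 0)
          (trans (sym (trans (sym es) (cong s (junction-in-C l b (sym ex))))) C-unbalanced))
    ... | at refl  | at refl  = refl
    ... | at refl  | after b  = ⊥-elim (junction-not-in-tail l b lM (sym ex))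
    ... | after a  | before b = ⊥-elim (C-tail-disjoint l k b a kM ex)
    ... | after a  | at refl  = ⊥-elim (junction-not-in-tail k a kM ex)
    ... | after a  | after b  = tail-distinct k l a kM b lM (sym ex)

    no-reversal-in-C : ∀ k l → suc k < L → l < M → ¬ Reversed k l
    no-reversal-in-C k l skL lM R with position L l
    ... | before b = s≢opposite-s (C-distinct l (suc k) z≤n b z≤n skL tail≡head) tail-sign
      where open Reversed R
    ... | at refl  = ℕP.0≢1+n (C-distinct 0 (suc k) z≤n (s≤s z≤n) z≤n skL (trans (sym closed) tail≡head))
      where open Reversed R
    ... | after b  = C-tail-disjoint (suc k) l skL b lM (sym tail≡head)
      where open Reversed R

    no-reversal-in-tail : ∀ k l → L < suc k → suc k < M → l < M → ¬ Reversed k l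
    no-reversal-in-tail k l Lsk skM lM R with position L l
    ... | before b = C-tail-disjoint l (suc k) b Lsk skM tail≡head
      where open Reversed R
    ... | at refl  = junction-not-in-tail (suc k) Lsk skM tail≡head
      where open Reversed R
    ... | after b  = s≢opposite-s (tail-distinct l (suc k) b lM Lsk skM tail≡head) tail-sign
      where open Reversed R

    closes-balanced : ∀ a → a < M → VertexDistinct a M → x M ≡ x a → s M ≡ s a → UnitFlowIn G τ S
    closes-balanced a aM D ex es with gap aM
    ... | (d , e) = balanced-segment a d (subst (VertexDistinct a) (sym e) D)
                      (subst (λ z → x z ≡ x a) (sym e) ex) (subst (λ z → s z ≡ s a) (sym e) es)

    tail-distinct-from : ∀ a → L < a → VertexDistinct a M
    tail-distinct-from a La k l ak kM al lM =
      tail-distinct k l (ℕP.<-≤-trans La ak) kM (ℕP.<-≤-trans La al) lM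

    above-nonzero : ∀ {p} → p ≢ 0 → ∀ k → p ≤ k → k ≢ 0
    above-nonzero p≢0 k pk refl = p≢0 (ℕP.n≤0⇒n≡0 pk)

    distinct-from-C : ∀ p → p ≢ 0 → VertexDistinct p M
    distinct-from-C p p≢0 k l pk kM pl lM eq with position L k | position L l
    ... | before a | before b = C-distinct k l z≤n a z≤n b eq
    ... | before a | at refl  = ⊥-elim (above-nonzero p≢0 k pk (junction-in-C k a (sym eq)))
    ... | before a | after b  = ⊥-elim (C-tail-disjoint k l a b lM eq)
    ... | at refl  | before b = ⊥-elim (above-nonzero p≢0 l pl (junction-in-C l b eq))
    ... | at refl  | at refl  = refl
    ... | at refl  | after b  = ⊥-elim (junction-not-in-tail l b lM eq)
    ... | after a  | before b = ⊥-elim (C-tail-disjoint l k b a kM (sym eq))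
    ... | after a  | at refl  = ⊥-elim (junction-not-in-tail k a kM (sym eq))
    ... | after a  | after b  = tail-distinct k l a kM b lM eq

    -- If the tail closes on itself at x r' with the opposite sign, C, the tail up to r' and
    -- the circuit r' … M form a long barbell.
    tail-closes-unbalanced : ∀ r → 1 ≤ r → r < T → x M ≡ x (L ℕ.+ r) → s M ≢ s (L ℕ.+ r) → ⊥
    tail-closes-unbalanced r r≥1 rT ex ne with gap {L ℕ.+ r} {M} (ℕP.+-monoʳ-< L rT)
    ... | (d , e) = noLB barbell
      where
      r' : ℕ
      r' = L ℕ.+ r
      Lr' : L < r'
      Lr' = L<L+ r r≥1
      r'M : r' < M
      r'M = ℕP.+-monoʳ-< L rT
      module C₁ = SegmentCircuit 0 L₀ C-distinct closed
      module C₂ = SegmentCircuit r' d (subst (VertexDistinct r') (sym e) (tail-distinct-from r' Lr'))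
                    (subst (λ z → x z ≡ x r') (sym e) ex)
      module P = SegmentPath L r (λ k l Lk kr Ll lr →
                   junction-tail-distinct M ℕP.≤-refl k l Lk (ℕP.≤-<-trans kr r'M) Ll (ℕP.≤-<-trans lr r'M))
      on-C₂ : ∀ {v} → OnCircuit {G} v C₂.circuit → Σ ℕ λ k → r' ≤ k × k < M × x k ≡ v
      on-C₂ oc = let (k , r'k , kb , eq) = C₂.on-circuit⁻ oc in k , r'k , subst (k <_) e kb , eq
      interior : ∀ (t : Fin (suc r)) → t ≢ zero → t ≢ fromℕ r →
                 ¬ OnCircuit {G} (x (L ℕ.+ toℕ t)) C₁.circuit × ¬ OnCircuit {G} (x (L ℕ.+ toℕ t)) C₂.circuit
      interior t t≢0 t≢r =
        (λ oc → let (k , _ , kL , eq) = C₁.on-circuit⁻ oc in tail-avoids-C i Li iM (k , kL , eq)) ,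
        (λ oc → let (k , r'k , kM , eq) = on-C₂ oc in
                ℕP.<-irrefl (sym (tail-distinct k i (ℕP.<-≤-trans Lr' r'k) kM Li iM eq)) (ℕP.<-≤-trans ir' r'k))
        where
        i : ℕ
        i = L ℕ.+ toℕ t
        t<r : toℕ t < r
        t<r = ℕP.≤∧≢⇒< (ℕP.≤-pred (FinP.toℕ<n t))
                (λ eq → t≢r (FinP.toℕ-injective (trans eq (sym (FinP.toℕ-fromℕ r)))))
        Li : L < i
        Li = L<L+ (toℕ t) (ℕP.n≢0⇒n>0 (λ eq → t≢0 (FinP.toℕ-injective eq)))
        ir' : i < r'
        ir' = ℕP.+-monoʳ-< L t<r
        iM : i < M
        iM = ℕP.<-trans ir' r'M
      barbell : LongBarbell G
      barbell = record
        { C₁ = C₁.circuit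
        ; C₂ = C₂.circuit
        ; unbal₁ = C₁.unbalanced C-unbalanced
        ; unbal₂ = C₂.unbalanced (subst (λ z → s z ≡ Sign.opposite (s r')) (sym e) (≢⇒opposite (s M) (s r') ne))
        ; disjoint = λ v on₁ on₂ →
            let (k₁ , _ , k₁L , eq₁) = C₁.on-circuit⁻ on₁ ; (k₂ , r'k₂ , k₂M , eq₂) = on-C₂ on₂ in
            tail-avoids-C k₂ (ℕP.<-≤-trans Lr' r'k₂) k₂M (k₁ , k₁L , trans eq₁ (sym eq₂))
        ; P = P.path
        ; start = zero , trans (sym closed) (cong x (sym (ℕP.+-identityʳ L)))
        ; end = zero , cong x (trans (ℕP.+-identityʳ r') (cong (L ℕ.+_) (sym (FinP.toℕ-fromℕ r))))
        ; interior = interior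
        }

    -- If the last step of C is reversed later, C is a loop-like 1-step circuit and the
    -- two steps coincide.
    reversal-closing-C : ∀ k l → suc k ≡ L → l < M → Reversed k l → k ≡ l
    reversal-closing-C k l skL lM R with position L l
    ... | before b = C-length (ℕP.m≤n⇒m<n∨m≡n (s≤s (z≤n {L₀})))
      where
      open Reversed R
      l≡0 : l ≡ 0
      l≡0 = junction-in-C l b (trans (cong x (sym skL)) (sym tail≡head))
      k<L : k < L
      k<L = subst (k <_) skL ℕP.≤-refl
      C-length : 1 < L ⊎ 1 ≡ L → k ≡ l
      C-length (inj₁ 1<L) = ⊥-elim (s≢opposite-s (cong suc l≡0)
        (subst (λ z → s (suc l) ≡ Sign.opposite (s z)) (sym 1≡k) head-sign))
        where
        1≡k : 1 ≡ k
        1≡k = C-distinct 1 k z≤n 1<L z≤n k<L (trans (cong (λ z → x (suc z)) (sym l≡0)) head≡tail)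
      C-length (inj₂ 1≡L) = trans (ℕP.suc-injective (trans skL (sym 1≡L))) (sym l≡0)
    ... | at refl  = ⊥-elim (s≢opposite-s (sym skL) tail-sign)
      where open Reversed R
    ... | after b  = ⊥-elim (junction-not-in-tail l b lM (trans (cong x (sym skL)) (sym tail≡head)))
      where open Reversed R

    repeated-edge : ∀ k l → k < M → l < M → ed k ≡ ed l → k ≡ l ⊎ (suc k ≡ M × Reversed k l)
    repeated-edge k l kM lM eq with same-edge-steps k l eq
    ... | inj₁ (ex , es) = inj₁ (step-determined k l kM lM ex es)
    ... | inj₂ R with position L (suc k)
    ...   | before a = ⊥-elim (no-reversal-in-C k l a lM R)
    ...   | at a     = inj₁ (reversal-closing-C k l a lM R)
    ...   | after a with ℕP.m≤n⇒m<n∨m≡n kM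
    ...     | inj₁ skM = ⊥-elim (no-reversal-in-tail k l a skM lM R)
    ...     | inj₂ skM = inj₂ (skM , R)

    -- The walk returns to x 0 with the sign of step 0: C and the closed tail form a short
    -- barbell, and all steps 0 … M-1 together carry a unit flow.
    short-barbell : x M ≡ x 0 → s M ≡ s 0 → UnitFlowIn G τ S
    short-barbell ex es = unit-flow (steps 0 M)
      (edge-distinct (steps 0 M) (steps-increasing 0 M) (λ p q eq →
         distinct (proj₂ (steps-range p)) (proj₂ (steps-range q)) eq))
      (λ v → trans (net-steps 0 M v) (trans (cong (λ z → ι 0 v - z) (ι-cong M 0 v ex es)) (+-inverseʳ (ι 0 v))))
      (here refl)
      where
      last-reversal : ∀ k l → suc k ≡ M → l < M → Reversed k l → k ≡ l
      last-reversal k l skM lM R with position L l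
      ... | before b = ⊥-elim (s≢opposite-s l≡0 (trans tail-sign (cong Sign.opposite (trans (cong s skM) es))))
        where
        open Reversed R
        l≡0 : l ≡ 0
        l≡0 = C-distinct l 0 z≤n b z≤n (s≤s z≤n) (trans tail≡head (trans (cong x skM) ex))
      ... | at refl = tail-length (ℕP.m≤n⇒m<n∨m≡n L<M)
        where
        open Reversed R
        tail-length : suc L < M ⊎ suc L ≡ M → k ≡ L
        tail-length (inj₁ sL<M) = ⊥-elim (s≢opposite-s sL≡k head-sign)
          where
          L<k : L < k
          L<k = ℕP.<-≤-trans (ℕP.n<1+n L) (ℕP.≤-pred (subst (suc (suc L) ≤_) (sym skM) sL<M))
          sL≡k : suc L ≡ k
          sL≡k = tail-distinct (suc L) k (ℕP.n<1+n L) sL<M L<k (subst (k <_) skM (ℕP.n<1+n k)) head≡tail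
        tail-length (inj₂ sL≡M) = ℕP.suc-injective (trans skM (sym sL≡M))
      ... | after b = ⊥-elim (junction-not-in-tail l b lM
                        (trans closed (sym (trans tail≡head (trans (cong x skM) ex)))))
        where open Reversed R
      distinct : ∀ {k l} → k < M → l < M → ed k ≡ ed l → k ≡ l
      distinct {k} {l} kM lM eq with repeated-edge k l kM lM eq
      ... | inj₁ k≡l = k≡l
      ... | inj₂ (skM , R) = last-reversal k l skM lM R

    -- The walk returns to C at x p (0 < p < L) with the opposite sign: the arc 0 … p of C
    -- and the tail form, with the rest of C, a theta; the arc plus the tail carry a unit flow.
    theta : ∀ p → p < L → 1 ≤ p → x M ≡ x p → s M ≡ Sign.opposite (s p) → UnitFlowIn G τ S
    theta p pL p≥1 ex es = unit-flow P
      (edge-distinct P (++-increasing (steps 0 p) (steps L T) (steps-increasing 0 p) (steps-increasing L T)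
         (λ a b → ℕP.<-≤-trans (proj₂ (steps-range a))
                    (ℕP.≤-trans (ℕP.<⇒≤ pL) (proj₁ (steps-range b)))))
         (λ a b eq → distinct (in-P a) (in-P b) eq))
      (λ v → trans (net-++ (steps 0 p) (steps L T) v)
        (trans (cong₂ _+_ (net-steps 0 p v) (net-steps L T v))
        (trans (cong₂ (λ z w → (ι 0 v - ι p v) + (z - w))
                      (ι-opposite L 0 v closed C-unbalanced) (ι-opposite M p v ex es))
               (cancel (ι 0 v) (ι p v)))))
      (∈-++⁺ˡ (start p p≥1))
      where
      cancel : ∀ (a b : ℤ) → (a - b) + ((- a) - (- b)) ≡ 0ℤ
      cancel = solve-∀
      start : ∀ K → 1 ≤ K → 0 ∈ steps 0 K
      start (suc K) _ = here refl
      P : List ℕ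
      P = steps 0 p ++ steps L T
      Arcs : ℕ → Set
      Arcs k = k < p ⊎ (L ≤ k × k < M)
      in-P : ∀ {k} → k ∈ P → Arcs k
      in-P mem with ∈-++⁻ (steps 0 p) mem
      ... | inj₁ a = inj₁ (proj₂ (steps-range a))
      ... | inj₂ b = inj₂ (steps-range b)
      below-M : ∀ {k} → Arcs k → k < M
      below-M (inj₁ kp) = ℕP.<-trans kp (ℕP.<-trans pL L<M)
      below-M (inj₂ (_ , kM)) = kM
      no-last-reversal : ∀ k l → suc k ≡ M → Arcs l → ¬ Reversed k l
      no-last-reversal k l skM lP R = at-p lP
        where
        open Reversed R
        xl≡xp : x l ≡ x p
        xl≡xp = trans tail≡head (trans (cong x skM) ex)
        at-p : Arcs l → ⊥
        at-p (inj₁ lp) = ℕP.<-irrefl (C-distinct l p z≤n (ℕP.<-trans lp pL) z≤n pL xl≡xp) lp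
        at-p (inj₂ (Ll , lM)) with position L l
        ... | before b = ℕP.<⇒≱ b Ll
        ... | at refl  = ℕP.<-irrefl (sym (junction-in-C p pL xl≡xp)) p≥1
        ... | after b  = C-tail-disjoint p l pL b lM (sym xl≡xp)
      distinct : ∀ {k l} → Arcs k → Arcs l → ed k ≡ ed l → k ≡ l
      distinct {k} {l} kA lA eq with repeated-edge k l (below-M kA) (below-M lA) eq
      ... | inj₁ k≡l = k≡l
      ... | inj₂ (skM , R) = ⊥-elim (no-last-reversal k l skM lA R)

    unit-flow-after-C : UnitFlowIn G τ S
    unit-flow-after-C with stop
    ... | inj₂ (r , r≥1 , rT , ex) with s M Sign.≟ s (L ℕ.+ r)
    ...   | yes es = closes-balanced (L ℕ.+ r) (ℕP.+-monoʳ-< L rT)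
                       (tail-distinct-from (L ℕ.+ r) (L<L+ r r≥1)) ex es
    ...   | no ne  = ⊥-elim (tail-closes-unbalanced r r≥1 rT ex ne)
    unit-flow-after-C | inj₁ (p , pL , xp) with p ℕ.≟ 0
    ...   | yes refl with s M Sign.≟ s L
    ...     | yes es = closes-balanced L L<M (junction-tail-distinct M ℕP.≤-refl) (trans (sym xp) (sym closed)) es
    ...     | no ne  = short-barbell (sym xp) (trans (≢⇒opposite (s M) (s L) ne)
                         (trans (cong Sign.opposite C-unbalanced) (SignP.opposite-involutive (s 0))))
    unit-flow-after-C | inj₁ (p , pL , xp) | no p≢0 with s M Sign.≟ s p
    ...     | yes es = closes-balanced p (ℕP.<-trans pL L<M) (distinct-from-C p p≢0) (sym xp) es
    ...     | no ne  = theta p pL (ℕP.n≢0⇒n>0 p≢0) (sym xp) (≢⇒opposite (s M) (s p) ne)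

-- Every walk following the flow yields a nonzero unit flow supported on its edges: stop
-- at the first repeated vertex x j = x i; the closed segment i … j is a circuit, balanced
-- (done) or unbalanced (continue with the walk shifted to start at i).
unit-flow-from-walk : (G : SignedGraph) (τ : HalfEdge G → Sign) → IsOrientation G τ → ¬ LongBarbell G →
  (S : Fin (m G) → Set) (W : ℕ → HalfEdge G) → (∀ k → S (proj₁ (W k))) →
  (∀ k → Continues G τ (W k) (W (suc k))) → UnitFlowIn G τ S
unit-flow-from-walk G τ τo noLB S W W∈S cont = closing (FirstStop.stop first-return)
  where
  open Walk G τ τo S W W∈S cont
  first-return : FirstStop (n G) x (λ v → v ≡ x 0)
  first-return = first-stop (n G) x (λ v → v ≡ x 0) (λ v → v ≟ x 0)
  open FirstStop first-return renaming (q to j)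

  prefix-distinct : VertexDistinct 0 j
  prefix-distinct zero    zero    _ _  _ _  _  = refl
  prefix-distinct zero    (suc l) _ _  _ lj eq = ⊥-elim (avoids (suc l) (s≤s z≤n) lj (sym eq))
  prefix-distinct (suc k) zero    _ kj _ _  eq = ⊥-elim (avoids (suc k) (s≤s z≤n) kj eq)
  prefix-distinct (suc k) (suc l) _ kj _ lj eq = dist (suc k) (suc l) (s≤s z≤n) kj (s≤s z≤n) lj eq

  circuit-at : ∀ i → i < j → x j ≡ x i → UnitFlowIn G τ S
  circuit-at i ij xj≡xi with gap ij
  ... | (d , e) with s j Sign.≟ s i
  ...   | yes es = balanced-segment i d D
                     (subst (λ z → x z ≡ x i) (sym e) xj≡xi) (subst (λ z → s z ≡ s i) (sym e) es)
    where
    D : VertexDistinct i (i ℕ.+ suc d)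
    D k l _ kb _ lb = prefix-distinct k l z≤n (subst (k <_) e kb) z≤n (subst (l <_) e lb)
  ...   | no ne = AfterUnbalancedCircuit.unit-flow-after-C G τ τo noLB S W′ (λ k → W∈S (i ℕ.+ k)) cont′ d
                    D′ closed′ unbalanced′
    where
    W′ : ℕ → HalfEdge G
    W′ k = W (i ℕ.+ k)
    cont′ : ∀ k → Continues G τ (W′ k) (W′ (suc k))
    cont′ k = subst (λ z → Continues G τ (W (i ℕ.+ k)) (W z)) (sym (ℕP.+-suc i k)) (cont (i ℕ.+ k))
    D′ : ∀ k l → 0 ≤ k → k < suc d → 0 ≤ l → l < suc d → attach G (W′ k) ≡ attach G (W′ l) → k ≡ l
    D′ k l _ kb _ lb eq = ℕP.+-cancelˡ-≡ i k l (prefix-distinct (i ℕ.+ k) (i ℕ.+ l)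
      z≤n (subst (i ℕ.+ k <_) e (ℕP.+-monoʳ-< i kb)) z≤n (subst (i ℕ.+ l <_) e (ℕP.+-monoʳ-< i lb)) eq)
    closed′ : attach G (W′ (suc d)) ≡ attach G (W′ 0)
    closed′ = trans (cong x e) (trans xj≡xi (cong x (sym (ℕP.+-identityʳ i))))
    unbalanced′ : τ (W′ (suc d)) ≡ Sign.opposite (τ (W′ 0))
    unbalanced′ = trans (cong s e) (trans (≢⇒opposite (s j) (s i) ne)
                    (cong (λ z → Sign.opposite (s z)) (sym (ℕP.+-identityʳ i))))

  closing : (x j ≡ x 0) ⊎ (Σ ℕ λ r → 1 ≤ r × r < j × x j ≡ x r) → UnitFlowIn G τ S
  closing (inj₁ eq)               = circuit-at 0 q≥1 eq
  closing (inj₂ (r , _ , rj , eq)) = circuit-at r rj eq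

-- Otherwise, at the far end v of h, with
-- t = τ (flipHalf h), every term t·τ(h'')ψ(h'') is ≥ 0 and the one of flipHalf h is > 0,
-- so t·∂ψ(v) > 0, contradicting ∂ψ(v) = 0.
module Continuation (G : SignedGraph) (τ : HalfEdge G → Sign)
    (ψ : Fin (m G) → ℤ) (ψ≥0 : ∀ e → 0ℤ ℤ.≤ ψ e) (∂ψ : ∀ v → boundary G τ ψ v ≡ 0ℤ) where

  Positive : Fin (m G) → Set
  Positive e = 0ℤ ℤ.< ψ e

  ContinuesPositively : HalfEdge G → HalfEdge G → Set
  ContinuesPositively h h' = Continues G τ h h' × Positive (proj₁ h')

  continues? : ∀ h → Dec (Σ (HalfEdge G) (ContinuesPositively h))
  continues? h with FinP.any? (λ e → half? (e , false) ⊎-dec half? (e , true))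
    where
    half? : ∀ h' → Dec (ContinuesPositively h h')
    half? h' = ((attach G h' ≟ attach G (flipHalf {G} h)) ×-dec
                (τ h' Sign.≟ Sign.opposite (τ (flipHalf {G} h)))) ×-dec (0ℤ <? ψ (proj₁ h'))
  ... | yes (e , inj₁ p) = yes ((e , false) , p)
  ... | yes (e , inj₂ p) = yes ((e , true) , p)
  ... | no ¬p = no λ { ((e , false) , p) → ¬p (e , inj₁ p) ; ((e , true) , p) → ¬p (e , inj₂ p) }

  module _ (h : HalfEdge G) (stuck : ¬ Σ (HalfEdge G) (ContinuesPositively h)) where
    private
      t : Sign
      t = τ (flipHalf {G} h)
      v : Fin (n G)
      v = attach G (flipHalf {G} h)

      aligned : ∀ (h'' : HalfEdge G) → signℤ t (signℤ t (ψ (proj₁ h''))) ≡ ψ (proj₁ h'')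
      aligned h'' = signℤ-twice t (ψ (proj₁ h''))

    -- With no continuation, every half-edge at v contributes with the sign t or not at all.
    term-nonneg : ∀ h'' → 0ℤ ℤ.≤ signℤ t (contrib G τ ψ v h'')
    term-nonneg h'' with attach G h'' ≟ v
    ... | no _ = subst (0ℤ ℤ.≤_) (sym (signℤ-0 t)) ℤP.≤-refl
    ... | yes at-v with τ h'' Sign.≟ t
    ...   | yes same = subst (0ℤ ℤ.≤_) (sym (trans (cong (λ z → signℤ t (signℤ z (ψ (proj₁ h'')))) same)
                         (aligned h''))) (ψ≥0 (proj₁ h''))
    ...   | no differ = subst (0ℤ ℤ.≤_) (sym (trans (cong (λ z → signℤ t (signℤ (τ h'') z)) ψ≡0)
                         (trans (cong (signℤ t) (signℤ-0 (τ h''))) (signℤ-0 t)))) ℤP.≤-refl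
      where
      ψ≡0 : ψ (proj₁ h'') ≡ 0ℤ
      ψ≡0 = ℤP.≤-antisym (ℤP.≮⇒≥ (λ pos → stuck (h'' , (at-v , ≢⇒opposite (τ h'') t differ) , pos)))
                         (ψ≥0 (proj₁ h''))

    edge-term : Fin (m G) → ℤ
    edge-term e = signℤ t (contrib G τ ψ v (e , false) + contrib G τ ψ v (e , true))

    edge-term-nonneg : ∀ e → 0ℤ ℤ.≤ edge-term e
    edge-term-nonneg e = subst (0ℤ ℤ.≤_) (sym (signℤ-+ t _ _))
      (+-mono-≤ (term-nonneg (e , false)) (term-nonneg (e , true)))

    edge-term-positive : Positive (proj₁ h) → 0ℤ ℤ.< edge-term (proj₁ h)
    edge-term-positive pos = paired h flip-term
      where
      flip-term : 0ℤ ℤ.< signℤ t (contrib G τ ψ v (flipHalf {G} h))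
      flip-term with attach G (flipHalf {G} h) ≟ v
      ... | no ne = ⊥-elim (ne refl)
      ... | yes _ = subst (0ℤ ℤ.<_) (sym (aligned h)) pos
      paired : ∀ hh → 0ℤ ℤ.< signℤ t (contrib G τ ψ v (flipHalf {G} hh)) → 0ℤ ℤ.< edge-term (proj₁ hh)
      paired (e , false) tp = subst (0ℤ ℤ.<_) (sym (signℤ-+ t _ _)) (+-mono-≤-< (term-nonneg (e , false)) tp)
      paired (e , true)  tp = subst (0ℤ ℤ.<_) (sym (signℤ-+ t _ _)) (+-mono-<-≤ tp (term-nonneg (e , true)))

    stuck-impossible : Positive (proj₁ h) → ⊥
    stuck-impossible pos = ℤP.<-irrefl refl (subst (0ℤ ℤ.<_) sum≡0
      (sumℤ-positive (m G) edge-term (proj₁ h) edge-term-nonneg (edge-term-positive pos)))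
      where
      sum≡0 : sumℤ (m G) edge-term ≡ 0ℤ
      sum≡0 = trans (sumℤ-signℤ t (m G) _) (trans (cong (signℤ t) (∂ψ v)) (signℤ-0 t))

  continuation : ∀ h → Positive (proj₁ h) → Σ (HalfEdge G) (ContinuesPositively h)
  continuation h pos with continues? h
  ... | yes c = c
  ... | no stuck = ⊥-elim (stuck-impossible h stuck pos)

  module _ (e₀ : Fin (m G)) (pos₀ : Positive e₀) where
    follow : ℕ → Σ (HalfEdge G) (λ h → Positive (proj₁ h))
    follow zero    = (e₀ , false) , pos₀
    follow (suc k) = let (h' , _ , pos') = continuation (proj₁ (follow k)) (proj₂ (follow k)) in h' , pos'

    walk : ℕ → HalfEdge G
    walk k = proj₁ (follow k)

    walk-continues : ∀ k → Continues G τ (walk k) (walk (suc k))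
    walk-continues k = proj₁ (proj₂ (continuation (proj₁ (follow k)) (proj₂ (follow k))))

UnitFlowThrough : (G : SignedGraph) → (HalfEdge G → Sign) → (Fin (m G) → ℤ) → Fin (m G) → Set
UnitFlowThrough G τ ψ e* = Σ (Fin (m G) → ℤ) λ u → (∀ v → boundary G τ u v ≡ 0ℤ) ×
  (∀ e → u e ≡ 0ℤ ⊎ u e ≡ 1ℤ) × (∀ e → u e ≡ 1ℤ → 0ℤ ℤ.< ψ e) × u e* ≡ 1ℤ

positive-form : ∀ {z} → 0ℤ ℤ.< z → Σ ℕ λ a → z ≡ ℤ.+ suc a
positive-form {ℤ.+ suc a} _          = a , refl
positive-form {ℤ.+ zero}  (+<+ ())

-- Total weight Σ |ψ e|, which decreases when a unit flow inside supp ψ is removed.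
weight : ∀ {k} → (Fin k → ℤ) → ℕ
weight {k} ψ = sumℕ k (λ e → ℤ.∣ ψ e ∣)

module Remove (G : SignedGraph) (τ : HalfEdge G → Sign)
              (ψ : Fin (m G) → ℤ) (ψ≥0 : ∀ e → 0ℤ ℤ.≤ ψ e) (∂ψ : ∀ v → boundary G τ ψ v ≡ 0ℤ)
              (u : Fin (m G) → ℤ) (∂u : ∀ v → boundary G τ u v ≡ 0ℤ)
              (u01 : ∀ e → u e ≡ 0ℤ ⊎ u e ≡ 1ℤ) (u≤ψ : ∀ e → u e ≡ 1ℤ → 0ℤ ℤ.< ψ e) where

  ψ′ : Fin (m G) → ℤ
  ψ′ e = ψ e - u e

  edgewise : ∀ e → (ψ′ e ≡ ψ e) ⊎ (Σ ℕ λ a → ψ e ≡ ℤ.+ suc a × ψ′ e ≡ ℤ.+ a)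
  edgewise e with u01 e
  ... | inj₁ u≡0 = inj₁ (trans (cong (λ z → ψ e - z) u≡0) (+-identityʳ (ψ e)))
  ... | inj₂ u≡1 with positive-form (u≤ψ e u≡1)
  ...   | (a , ψ≡) = inj₂ (a , ψ≡ , cong₂ _-_ ψ≡ u≡1)

  ψ′≥0 : ∀ e → 0ℤ ℤ.≤ ψ′ e
  ψ′≥0 e with edgewise e
  ... | inj₁ eq          = subst (0ℤ ℤ.≤_) (sym eq) (ψ≥0 e)
  ... | inj₂ (a , _ , eq) = subst (0ℤ ℤ.≤_) (sym eq) (+≤+ z≤n)

  ∂ψ′ : ∀ v → boundary G τ ψ′ v ≡ 0ℤ
  ∂ψ′ = boundary-difference G τ ψ u ∂ψ ∂u

  ψ′-support : ∀ e → 0ℤ ℤ.< ψ′ e → 0ℤ ℤ.< ψ e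
  ψ′-support e pos with edgewise e
  ... | inj₁ eq           = subst (0ℤ ℤ.<_) eq pos
  ... | inj₂ (a , ψ≡ , _) = subst (0ℤ ℤ.<_) (sym ψ≡) (+<+ (s≤s z≤n))

  unchanged : ∀ e → u e ≡ 0ℤ → ψ′ e ≡ ψ e
  unchanged e u≡0 = trans (cong (λ z → ψ e - z) u≡0) (+-identityʳ (ψ e))

  lighter : ∀ e₁ → u e₁ ≡ 1ℤ → weight ψ′ < weight ψ
  lighter e₁ u≡1 = sumℕ-strict (m G) _ _ shrink e₁ drop
    where
    shrink : ∀ e → ℤ.∣ ψ′ e ∣ ≤ ℤ.∣ ψ e ∣
    shrink e with edgewise e
    ... | inj₁ eq            = ℕP.≤-reflexive (cong ℤ.∣_∣ eq)
    ... | inj₂ (a , ψ≡ , eq) = subst₂ _≤_ (sym (cong ℤ.∣_∣ eq)) (sym (cong ℤ.∣_∣ ψ≡)) (ℕP.n≤1+n a)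
    drop : ℤ.∣ ψ′ e₁ ∣ < ℤ.∣ ψ e₁ ∣
    drop with positive-form (u≤ψ e₁ u≡1)
    ... | (a , ψ≡) = subst₂ _<_ (sym (cong ℤ.∣_∣ (cong₂ _-_ ψ≡ u≡1))) (sym (cong ℤ.∣_∣ ψ≡)) (ℕP.n<1+n a)

module _ (G : SignedGraph) (τ : HalfEdge G → Sign) (τo : IsOrientation G τ) (noLB : ¬ LongBarbell G) where

  Lighter : (Fin (m G) → ℤ) → Fin (m G) → Set
  Lighter ψ e* = Σ (Fin (m G) → ℤ) λ ψ′ → (∀ e → 0ℤ ℤ.≤ ψ′ e) × (∀ v → boundary G τ ψ′ v ≡ 0ℤ) ×
    weight ψ′ < weight ψ × 0ℤ ℤ.< ψ′ e* × (∀ e → 0ℤ ℤ.< ψ′ e → 0ℤ ℤ.< ψ e)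

  -- Take the unit flow of a walk starting at e*: either it uses e*, or removing it from ψ
  -- gives a lighter flow.
  through-or-lighter : ∀ ψ → (∀ e → 0ℤ ℤ.≤ ψ e) → (∀ v → boundary G τ ψ v ≡ 0ℤ) →
                       ∀ e* → 0ℤ ℤ.< ψ e* → UnitFlowThrough G τ ψ e* ⊎ Lighter ψ e*
  through-or-lighter ψ ψ≥0 ∂ψ e* pos* = split walk-flow
    where
    open Continuation G τ ψ ψ≥0 ∂ψ
    walk-flow : UnitFlowIn G τ Positive
    walk-flow = unit-flow-from-walk G τ τo noLB Positive (walk e* pos*) (λ k → proj₂ (follow e* pos* k))
                  (walk-continues e* pos*)
    split : UnitFlowIn G τ Positive → UnitFlowThrough G τ ψ e* ⊎ Lighter ψ e*
    split (u , ∂u , u01 , u≤ψ , (e₁ , u₁)) with u01 e*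
    ... | inj₂ u*≡1 = inj₁ (u , ∂u , u01 , u≤ψ , u*≡1)
    ... | inj₁ u*≡0 = inj₂ (ψ′ , ψ′≥0 , ∂ψ′ , lighter e₁ u₁ ,
                            subst (0ℤ ℤ.<_) (sym (unchanged e* u*≡0)) pos* , ψ′-support)
      where open Remove G τ ψ ψ≥0 ∂ψ u ∂u u01 u≤ψ

  unit-flow-through : ∀ μ ψ → (∀ e → 0ℤ ℤ.≤ ψ e) → (∀ v → boundary G τ ψ v ≡ 0ℤ) → weight ψ ≤ μ →
                      ∀ e* → 0ℤ ℤ.< ψ e* → UnitFlowThrough G τ ψ e*
  unit-flow-through μ ψ ψ≥0 ∂ψ bound e* pos* with through-or-lighter ψ ψ≥0 ∂ψ e* pos*
  ... | inj₁ through = through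
  ... | inj₂ (ψ′ , ψ′≥0 , ∂ψ′ , lighter , pos′ , support) with μ
  ...   | zero   = ⊥-elim (ℕP.n≮0 (ℕP.<-≤-trans lighter bound))
  ...   | suc μ′ with unit-flow-through μ′ ψ′ ψ′≥0 ∂ψ′ (ℕP.≤-pred (ℕP.<-≤-trans lighter bound)) e* pos′
  ...     | (u , ∂u , u01 , u≤ψ′ , u*) = u , ∂u , u01 , (λ e o → support e (u≤ψ′ e o)) , u*

bits : ∀ {k} → (Fin k → Bool) → Fin k → ℤ
bits g e = if g e then 1ℤ else 0ℤ

indicator-≤ : ∀ {A B : Set} (a : Dec A) (b : Dec B) → (A → B) →
              (if does a then 1 else 0) ≤ (if does b then 1 else 0)
indicator-≤ (yes p) (yes q) h = ℕP.≤-refl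
indicator-≤ (yes p) (no q)  h = ⊥-elim (q (h p))
indicator-≤ (no p)  (yes q) h = z≤n
indicator-≤ (no p)  (no q)  h = ℕP.≤-refl

indicator-< : ∀ {A B : Set} (a : Dec A) (b : Dec B) → ¬ A → B →
              (if does a then 1 else 0) < (if does b then 1 else 0)
indicator-< (yes p) _       ¬a _ = ⊥-elim (¬a p)
indicator-< (no p)  (yes q) ¬a b = s≤s z≤n
indicator-< (no p)  (no q)  ¬a b = ⊥-elim (q b)

module SaturatingLayer (G : SignedGraph) (τ : HalfEdge G → Sign) (τo : IsOrientation G τ)
    (noLB : ¬ LongBarbell G) (f : Fin (m G) → ℤ) (f≥0 : ∀ e → 0ℤ ℤ.≤ f e)
    (∂f : ∀ v → boundary G τ f v ≡ 0ℤ) (K : ℕ) (f≤B : ∀ e → f e ℤ.≤ ℤ.+ suc K) where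

  B : ℤ
  B = ℤ.+ suc K

  Layer : (Fin (m G) → Bool) → Set
  Layer g = (∀ v → boundary G τ (bits g) v ≡ 0ℤ) × (∀ e → g e ≡ true → 0ℤ ℤ.< f e)

  Uncovered : (Fin (m G) → Bool) → Fin (m G) → Set
  Uncovered g e = f e ≡ B × g e ≡ false

  uncovered? : ∀ g e → Dec (Uncovered g e)
  uncovered? g e = (f e ℤP.≟ B) ×-dec (g e BoolP.≟ false)

  uncovered-count : (Fin (m G) → Bool) → ℕ
  uncovered-count g = sumℕ (m G) (λ e → if does (uncovered? g e) then 1 else 0)

  module Improve (g : Fin (m G) → Bool) (layer : Layer g) (e* : Fin (m G)) (unc* : Uncovered g e*) where

    -- φ = f - B·g is a flow with |φ| ≤ B, non-negative off g and non-positive on g.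
    φ : Fin (m G) → ℤ
    φ e = if g e then f e - B else f e

    φ-linear : ∀ e → φ e ≡ f e + - (B * bits g e)
    φ-linear e with g e
    ... | true  = cong (λ z → f e + - z) (sym (*-identityʳ B))
    ... | false = trans (sym (+-identityʳ (f e))) (cong (λ z → f e + - z) (sym (*-zeroʳ B)))

    ∂φ : ∀ v → boundary G τ φ v ≡ 0ℤ
    ∂φ v = trans (boundary-ext G τ φ _ φ-linear v)
      (boundary-difference G τ f (λ e → B * bits g e) ∂f
        (λ v → trans (boundary-scale G τ B (bits g) v) (trans (cong (B *_) (proj₁ layer v)) (*-zeroʳ B))) v)

    -- Reverse the edges where φ < 0, so that ψ = |φ| is a non-negative flow for τ′.
    ρ : Fin (m G) → Sign
    ρ e = if does (φ e <? 0ℤ) then Sign.- else Sign.+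

    ρ-nonneg : ∀ e → 0ℤ ℤ.≤ φ e → ρ e ≡ Sign.+
    ρ-nonneg e le with φ e <? 0ℤ
    ... | yes lt = ⊥-elim (ℤP.<-irrefl refl (ℤP.<-≤-trans lt le))
    ... | no _   = refl

    ρ-neg : ∀ e → φ e ℤ.< 0ℤ → ρ e ≡ Sign.-
    ρ-neg e lt with φ e <? 0ℤ
    ... | yes _ = refl
    ... | no nl = ⊥-elim (nl lt)

    ψ : Fin (m G) → ℤ
    ψ e = signℤ (ρ e) (φ e)

    ψ≥0 : ∀ e → 0ℤ ℤ.≤ ψ e
    ψ≥0 e with φ e <? 0ℤ
    ... | yes lt = ℤP.<⇒≤ (neg-mono-< lt)
    ... | no nl  = ≮⇒≥ nl

    τ′ : HalfEdge G → Sign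
    τ′ = reorient G τ ρ

    τ′o : IsOrientation G τ′
    τ′o = reorient-orientation G τ ρ τo

    φ*≡B : φ e* ≡ B
    φ*≡B = trans (cong (λ b → if b then f e* - B else f e*) (proj₂ unc*)) (proj₁ unc*)

    ψ*>0 : 0ℤ ℤ.< ψ e*
    ψ*>0 = subst (0ℤ ℤ.<_) (sym (trans (cong (λ t → signℤ t (φ e*)) (ρ-nonneg e* (subst (0ℤ ℤ.≤_) (sym φ*≡B)
             (+≤+ z≤n)))) φ*≡B)) (+<+ (s≤s z≤n))

    ∂ψ : ∀ v → boundary G τ′ ψ v ≡ 0ℤ
    ∂ψ v = trans (reorient-boundary G τ ρ φ v) (∂φ v)

    through : UnitFlowThrough G τ′ ψ e*
    through = unit-flow-through G τ′ τ′o noLB (weight ψ) ψ ψ≥0 ∂ψ ℕP.≤-refl e* ψ*>0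

  -- Switching g along a unit flow u through e* inside supp ψ (for τ′); uF is u read in τ.
  module Switch (g : Fin (m G) → Bool) (layer : Layer g) (e* : Fin (m G)) (unc* : Uncovered g e*)
                (u : Fin (m G) → ℤ) (∂u : ∀ v → boundary G (Improve.τ′ g layer e* unc*) u v ≡ 0ℤ)
                (u01 : ∀ e → u e ≡ 0ℤ ⊎ u e ≡ 1ℤ)
                (u≤ψ : ∀ e → u e ≡ 1ℤ → 0ℤ ℤ.< Improve.ψ g layer e* unc* e) (u* : u e* ≡ 1ℤ) where

    open Improve g layer e* unc*

    uF : Fin (m G) → ℤ
    uF e = signℤ (ρ e) (u e)

    ∂uF : ∀ v → boundary G τ uF v ≡ 0ℤ
    ∂uF v = trans (sym (reorient-boundary G τ ρ uF v))
      (trans (boundary-ext G τ′ _ u (λ e → signℤ-twice (ρ e) (u e)) v) (∂u v))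

    on-u-outside-g : ∀ e → u e ≡ 1ℤ → g e ≡ false → uF e ≡ 1ℤ × 0ℤ ℤ.< f e
    on-u-outside-g e u≡1 g≡f = trans (cong (λ t → signℤ t (u e)) (ρ-nonneg e φ≥0)) u≡1 ,
      subst (0ℤ ℤ.<_) (trans (cong (λ t → signℤ t (φ e)) (ρ-nonneg e φ≥0)) φ≡f) (u≤ψ e u≡1)
      where
      φ≡f : φ e ≡ f e
      φ≡f = cong (λ b → if b then f e - B else f e) g≡f
      φ≥0 : 0ℤ ℤ.≤ φ e
      φ≥0 = subst (0ℤ ℤ.≤_) (sym φ≡f) (f≥0 e)

    on-u-inside-g : ∀ e → u e ≡ 1ℤ → g e ≡ true → uF e ≡ - 1ℤ × f e ≢ B
    on-u-inside-g e u≡1 g≡t = trans (cong (λ t → signℤ t (u e)) (ρ-neg e φ<0)) (cong -_ u≡1) , f≢B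
      where
      φ≡f-B : φ e ≡ f e - B
      φ≡f-B = cong (λ b → if b then f e - B else f e) g≡t
      φ≢0 : φ e ≢ 0ℤ
      φ≢0 eq = ℤP.<-irrefl refl (subst (0ℤ ℤ.<_) (trans (cong (signℤ (ρ e)) eq) (signℤ-0 (ρ e))) (u≤ψ e u≡1))
      φ<0 : φ e ℤ.< 0ℤ
      φ<0 = ℤP.≤∧≢⇒< (subst (ℤ._≤ 0ℤ) (sym φ≡f-B) (i≤j⇒i-j≤0 (f≤B e))) φ≢0
      f≢B : f e ≢ B
      f≢B eq = φ≢0 (trans φ≡f-B (trans (cong (_- B) eq) (+-inverseʳ B)))

    g′ : Fin (m G) → Bool
    g′ e = if does (u e ℤP.≟ 1ℤ) then not (g e) else g e

    g′-off-u : ∀ e → u e ≡ 0ℤ → g′ e ≡ g e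
    g′-off-u e u≡0 with u e ℤP.≟ 1ℤ
    ... | yes u≡1 = ⊥-elim (0≢1 (trans (sym u≡0) u≡1))
      where
      0≢1 : 0ℤ ≢ 1ℤ
      0≢1 ()
    ... | no _    = refl

    g′-on-u : ∀ e → u e ≡ 1ℤ → g′ e ≡ not (g e)
    g′-on-u e u≡1 with u e ℤP.≟ 1ℤ
    ... | yes _ = refl
    ... | no ne = ⊥-elim (ne u≡1)

    bits-g′ : ∀ e → bits g′ e ≡ bits g e + uF e
    bits-g′ e with u01 e
    ... | inj₁ u≡0 = trans (cong (λ b → if b then 1ℤ else 0ℤ) (g′-off-u e u≡0))
          (sym (trans (cong (bits g e +_) (trans (cong (signℤ (ρ e)) u≡0) (signℤ-0 (ρ e)))) (+-identityʳ _)))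
    ... | inj₂ u≡1 = by-g (g e) refl
      where
      by-g : ∀ b → g e ≡ b → bits g′ e ≡ bits g e + uF e
      by-g false g≡ = trans (cong (λ b → if b then 1ℤ else 0ℤ) (trans (g′-on-u e u≡1) (cong not g≡)))
        (sym (cong₂ _+_ (cong (λ b → if b then 1ℤ else 0ℤ) g≡) (proj₁ (on-u-outside-g e u≡1 g≡))))
      by-g true g≡ = trans (cong (λ b → if b then 1ℤ else 0ℤ) (trans (g′-on-u e u≡1) (cong not g≡)))
        (sym (cong₂ _+_ (cong (λ b → if b then 1ℤ else 0ℤ) g≡) (proj₁ (on-u-inside-g e u≡1 g≡))))

    layer′ : Layer g′
    layer′ = (λ v → trans (boundary-ext G τ (bits g′) _ bits-g′ v)
               (trans (boundary-+ G τ (bits g) uF v) (cong₂ _+_ (proj₁ layer v) (∂uF v)))) ,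
             support
      where
      support : ∀ e → g′ e ≡ true → 0ℤ ℤ.< f e
      support e g′≡t with u01 e
      ... | inj₁ u≡0 = proj₂ layer e (trans (sym (g′-off-u e u≡0)) g′≡t)
      ... | inj₂ u≡1 = by-g (g e) refl
        where
        by-g : ∀ b → g e ≡ b → 0ℤ ℤ.< f e
        by-g false g≡ = proj₂ (on-u-outside-g e u≡1 g≡)
        by-g true  g≡ = ⊥-elim (BoolP.not-¬ (trans (sym (cong not g≡)) (trans (sym (g′-on-u e u≡1)) g′≡t)) refl)

    uncovered-before : ∀ e → Uncovered g′ e → Uncovered g e
    uncovered-before e (f≡B , g′≡f) with u01 e
    ... | inj₁ u≡0 = f≡B , trans (sym (g′-off-u e u≡0)) g′≡f
    ... | inj₂ u≡1 = by-g (g e) refl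
      where
      by-g : ∀ b → g e ≡ b → Uncovered g e
      by-g false g≡ = f≡B , g≡
      by-g true  g≡ = ⊥-elim (proj₂ (on-u-inside-g e u≡1 g≡) f≡B)

    covers-e* : ¬ Uncovered g′ e*
    covers-e* (_ , g′≡f) =
      BoolP.not-¬ (trans (sym (trans (g′-on-u e* u*) (cong not (proj₂ unc*)))) g′≡f) refl

    fewer-uncovered : uncovered-count g′ < uncovered-count g
    fewer-uncovered = sumℕ-strict (m G) _ _
      (λ e → indicator-≤ (uncovered? g′ e) (uncovered? g e) (uncovered-before e)) e*
      (indicator-< (uncovered? g′ e*) (uncovered? g e*) covers-e* unc*)

  improve : ∀ g → Layer g → ∀ e* → Uncovered g e* →
            Σ (Fin (m G) → Bool) λ g′ → Layer g′ × uncovered-count g′ < uncovered-count g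
  improve g layer e* unc* = g′ , layer′ , fewer-uncovered
    where
    open Improve g layer e* unc* using (through)
    open Switch g layer e* unc* (proj₁ through) (proj₁ (proj₂ through)) (proj₁ (proj₂ (proj₂ through)))
                (proj₁ (proj₂ (proj₂ (proj₂ through)))) (proj₂ (proj₂ (proj₂ (proj₂ through))))

  Saturating : Set
  Saturating = Σ (Fin (m G) → Bool) λ g → Layer g × (∀ e → f e ≡ B → g e ≡ true)

  covered-or-improvable : ∀ g → Layer g → (∀ e → f e ≡ B → g e ≡ true) ⊎
    (Σ (Fin (m G) → Bool) λ g′ → Layer g′ × uncovered-count g′ < uncovered-count g)
  covered-or-improvable g layer with FinP.any? (uncovered? g)
  ... | yes (e* , unc*) = inj₂ (improve g layer e* unc*)
  ... | no none = inj₁ covered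
    where
    covered : ∀ e → f e ≡ B → g e ≡ true
    covered e f≡B with g e in g≡
    ... | true  = refl
    ... | false = ⊥-elim (none (e , f≡B , g≡))

  saturate : ∀ μ g → Layer g → uncovered-count g ≤ μ → Saturating
  saturate μ g layer bound with covered-or-improvable g layer
  ... | inj₁ covered = g , layer , covered
  ... | inj₂ (g′ , layer′ , fewer) with μ
  ...   | zero   = ⊥-elim (ℕP.n≮0 (ℕP.<-≤-trans fewer bound))
  ...   | suc μ′ = saturate μ′ g′ layer′ (ℕP.≤-pred (ℕP.<-≤-trans fewer bound))

  empty-layer : Layer (λ _ → false)
  empty-layer = boundary-zero G τ , (λ e ())

  saturating-layer : Saturating
  saturating-layer = saturate (uncovered-count (λ _ → false)) (λ _ → false) empty-layer ℕP.≤-refl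

-- Peeling: a non-negative flow with values ≤ K is a sum of K non-negative 2-flows.  Remove
-- a saturating layer g of f ≤ K+1; f - g is a non-negative flow with values ≤ K.
peel : (G : SignedGraph) (τ : HalfEdge G → Sign) → IsOrientation G τ → ¬ LongBarbell G →
  ∀ K (f : Fin (m G) → ℤ) → (∀ e → 0ℤ ℤ.≤ f e) → (∀ v → boundary G τ f v ≡ 0ℤ) → (∀ e → f e ℤ.≤ ℤ.+ K) →
  Σ (Fin K → Fin (m G) → ℤ) (λ fs → (∀ i → IsKFlow 2 G τ (fs i) × NonNegative {G} (fs i)) ×
                                    (∀ e → f e ≡ sumℤ K (λ i → fs i e)))
peel G τ τo noLB zero f f≥0 ∂f f≤0 = (λ ()) , (λ ()) , (λ e → ℤP.≤-antisym (f≤0 e) (f≥0 e))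
peel G τ τo noLB (suc K) f f≥0 ∂f f≤B
  with SaturatingLayer.saturating-layer G τ τo noLB f f≥0 ∂f K f≤B
... | (g , (∂g , g≤f) , saturated) with peel G τ τo noLB K rest rest≥0 ∂rest rest≤K
  where
  rest : Fin (m G) → ℤ
  rest e = f e - bits g e
  ∂rest : ∀ v → boundary G τ rest v ≡ 0ℤ
  ∂rest = boundary-difference G τ f (bits g) ∂f ∂g
  rest≥0 : ∀ e → 0ℤ ℤ.≤ rest e
  rest≥0 e with g e in g≡
  ... | false = subst (0ℤ ℤ.≤_) (sym (+-identityʳ (f e))) (f≥0 e)
  ... | true with positive-form (g≤f e g≡)
  ...   | (a , f≡) = subst (λ z → 0ℤ ℤ.≤ z - 1ℤ) (sym f≡) (+≤+ z≤n)
  rest≤K : ∀ e → rest e ℤ.≤ ℤ.+ K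
  rest≤K e with g e in g≡
  ... | true = ≤-pred (f≤B e)
    where
    ≤-pred : ∀ {z} → z ℤ.≤ ℤ.+ suc K → z - 1ℤ ℤ.≤ ℤ.+ K
    ≤-pred {z} le = subst₂ ℤ._≤_ refl (lemma K) (+-monoˡ-≤ (- 1ℤ) le)
      where
      lemma : ∀ K → ℤ.+ suc K - 1ℤ ≡ ℤ.+ K
      lemma K = solve-∀
  ... | false = subst (ℤ._≤ ℤ.+ K) (sym (+-identityʳ (f e))) (unsaturated (f≥0 e) (f≤B e) f≢B)
    where
    f≢B : f e ≢ ℤ.+ suc K
    f≢B eq with trans (sym (saturated e eq)) g≡
    ... | ()
    unsaturated : ∀ {z} → 0ℤ ℤ.≤ z → z ℤ.≤ ℤ.+ suc K → z ≢ ℤ.+ suc K → z ℤ.≤ ℤ.+ K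
    unsaturated (+≤+ _) (+≤+ le) ne = +≤+ (ℕP.≤-pred (ℕP.≤∧≢⇒< le (λ eq → ne (cong ℤ.+_ eq))))
... | (fs , fs-flows , f-rest≡Σ) = layers , layer-flows , f≡Σ
  where
  layers : Fin (suc K) → Fin (m G) → ℤ
  layers zero    = bits g
  layers (suc i) = fs i
  g-flow : IsKFlow 2 G τ (bits g) × NonNegative {G} (bits g)
  g-flow = ((τo , ∂g) , bounded) , nonneg
    where
    bounded : ∀ e → ∣ bits g e ∣≤ 1
    bounded e with g e
    ... | true  = -≤+ , ℤP.≤-refl
    ... | false = -≤+ , +≤+ z≤n
    nonneg : NonNegative {G} (bits g)
    nonneg e with g e
    ... | true  = +≤+ z≤n
    ... | false = +≤+ z≤n
  layer-flows : ∀ i → IsKFlow 2 G τ (layers i) × NonNegative {G} (layers i)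
  layer-flows zero    = g-flow
  layer-flows (suc i) = fs-flows i
  f≡Σ : ∀ e → f e ≡ sumℤ (suc K) (λ i → layers i e)
  f≡Σ e = trans (split (f e) (bits g e)) (cong (bits g e +_) (f-rest≡Σ e))
    where
    split : ∀ (a b : ℤ) → a ≡ b + (a - b)
    split = solve-∀

theorem4p3 : (G : SignedGraph) → ¬ LongBarbell G →
    (k : ℕ) → 2 ≤ k →
    (τ : HalfEdge G → Sign) (f : Fin (m G) → ℤ) →
    IsKFlow k G τ f → NonNegative {G} f →
    Σ (Fin (k ∸ 1) → Fin (m G) → ℤ) (λ fs →
      (∀ i → IsKFlow 2 G τ (fs i) × NonNegative {G} (fs i)) ×
      (∀ e → f e ≡ sumℤ (k ∸ 1) (λ i → fs i e)))
theorem4p3 G noLB k _ τ f ((τo , ∂f) , bounded) f≥0 =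
  peel G τ τo noLB (k ∸ 1) f f≥0 ∂f (λ e → proj₂ (bounded e))
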